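{- Let $n$ be a positive integer and $\mathcal{D}$ a distribution over $[n+1]$ with $p_i=\mathcal{D}(\{i\})$, and let $\varepsilon=p_1+\dots+p_n>0$. Let $S$ and $S'$ be sets formed by $m$ and $m'$ independent samples from $\mathcal{D}$ respectively (all samples independent), where $m\cdot m'\ge 100n/\varepsilon^2$ and $m,m'\ge 200/\varepsilon$. Then with probability at least $0.99$ there exists $i\in[n]$ that appears in both $S$ and $S'$. -}

module Defs where

open import Level using (Level; _⊔_) renaming (suc to lsuc)
open import Algebra.Bundles using (CommutativeRing)
open import Relation.Binary.Core using (Rel)
open import Relation.Binary.Structures using (IsTotalOrder)
open import Relation.Nullary using (¬_; Dec; yes; no)
open import Relation.Nullary.Decidable using (_×-dec_)
open import Data.Product using (_×_; ∃; _,_)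
open import Data.Nat using (ℕ; zero; suc)
open import Data.Fin using (Fin; inject₁)
open import Data.Fin.Properties using (any?) renaming (_≟_ to _≟ᶠ_)
open import Data.Vec using (Vec; []; _∷_)
open import Data.Vec.Membership.Propositional using (_∈_)
import Data.Vec.Membership.DecPropositional as DecMem

record OrderedField (c ℓ₁ ℓ₂ : Level) : Set (lsuc (c ⊔ ℓ₁ ⊔ ℓ₂)) where
  field
    commutativeRing : CommutativeRing c ℓ₁
  open CommutativeRing commutativeRing public
  field
    _≤_          : Rel Carrier ℓ₂
    isTotalOrder : IsTotalOrder _≈_ _≤_
    nontrivial   : ¬ (0# ≈ 1#)
    +-monoˡ-≤    : ∀ {x y} z → x ≤ y → (x + z) ≤ (y + z)
    *-nonneg     : ∀ {x y} → 0# ≤ x → 0# ≤ y → 0# ≤ (x * y)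
    inverse      : ∀ x → ¬ (x ≈ 0#) → ∃ λ y → (x * y) ≈ 1#

  _<_ : Rel Carrier (ℓ₁ ⊔ ℓ₂)
  x < y = (x ≤ y) × ¬ (x ≈ y)

  fromℕ : ℕ → Carrier
  fromℕ zero    = 0#
  fromℕ (suc k) = 1# + fromℕ k

  sumFin : ∀ k → (Fin k → Carrier) → Carrier
  sumFin zero    f = 0#
  sumFin (suc k) f = f Fin.zero + sumFin k (λ i → f (Fin.suc i))

  sumSeq : ∀ {N} k → (Vec (Fin N) k → Carrier) → Carrier
  sumSeq {N} zero    f = f []
  sumSeq {N} (suc k) f = sumFin N (λ i → sumSeq k (λ v → f (i ∷ v)))

  weight : ∀ {N k} → (Fin N → Carrier) → Vec (Fin N) k → Carrier
  weight p []      = 1#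
  weight p (x ∷ v) = p x * weight p v

  indicator : ∀ {a} {A : Set a} → Dec A → Carrier
  indicator (yes _) = 1#
  indicator (no _)  = 0#

  IsDistribution : ∀ {N} → (Fin N → Carrier) → Set (ℓ₁ ⊔ ℓ₂)
  IsDistribution {N} p = (∀ i → 0# ≤ p i) × (sumFin N p ≈ 1#)

  -- probability that the event E (a decidable predicate on pairs of sample
  -- sequences of lengths m, m') holds, when all m + m' samples are i.i.d. from p
  Prob2 : ∀ {N} m m' (p : Fin N → Carrier)
          → {e : Level} (E : Vec (Fin N) m → Vec (Fin N) m' → Set e)
          → (∀ s s' → Dec (E s s')) → Carrier
  Prob2 m m' p E E? =
    sumSeq m (λ s → sumSeq m' (λ s' → (weight p s * weight p s') * indicator (E? s s')))

-- Elements of [n+1] are Fin (suc n); [n] is the image of inject₁ : Fin n → Fin (suc n)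
-- (the first n elements); the remaining element is the last one.
CommonElement : ∀ {n m m'} → Vec (Fin (suc n)) m → Vec (Fin (suc n)) m' → Set
CommonElement {n} S S' = ∃ λ (i : Fin n) → (inject₁ i ∈ S) × (inject₁ i ∈ S')

commonElement? : ∀ {n m m'} (S : Vec (Fin (suc n)) m) (S' : Vec (Fin (suc n)) m')
                 → Dec (CommonElement S S')
commonElement? {n} S S' = any? (λ i → (inject₁ i ∈? S) ×-dec (inject₁ i ∈? S'))
  where open DecMem (_≟ᶠ_ {suc n}) using (_∈?_)

-- Write q j = p (inject₁ j), α j = (1 - q j) ^ m and β j = (1 - q j) ^ m'.
-- For fixed S, the event that S' avoids S ∩ [n] has probability
-- E[Π_{i ∈ S'} f i], a product over the distinct symbols of S' with f i = 0 on
-- S ∩ [n] and 1 elsewhere.  Occurrences of distinct symbols in an i.i.d.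
-- sample are negatively dependent, E[Π_{i ∈ S} f i] ≤ Π_i E[f i ^ [i ∈ S]];
-- applied to S' and then to S this bounds the probability of no common
-- element by Π_j (α j + β j - α j β j).  Bernoulli-type estimates bound each
-- factor by (1 + 9 w j / 100) ^ -2 with w j = m q j · (m' q j ⊓ 1) (for
-- m ≤ m'), the hypotheses give Σ_j w j ≥ 100, and Π_j (1 + t j) ≥ 1 + Σ_j t j
-- then bounds the product by 1 / 100.

module Submission where

open import Defs
open import Level using (Level)
open import Data.Nat as ℕ using (ℕ; zero; suc; NonZero) renaming (_*_ to _*ℕ_)
import Data.Nat.Properties as ℕₚ
open import Data.Integer as ℤ using (ℤ; +_; -[1+_])
import Data.Integer.Properties as ℤₚ
open import Data.Sign as Sign using (Sign)
open import Data.Bool using (true; false; if_then_else_)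
open import Data.Maybe using (Maybe; just; nothing)
open import Data.Product using (∃; _,_; proj₁; proj₂)
open import Data.Sum using (inj₁; inj₂; [_,_]′)
open import Data.Empty using (⊥-elim)
open import Data.Fin as Fin using (Fin; inject₁)
open import Data.Fin.Properties using (_≟_; any?; fromℕ≢inject₁)
open import Data.Vec using (Vec; []; _∷_)
open import Data.Vec.Relation.Unary.Any using (here; there)
open import Data.Vec.Membership.Propositional using (_∈_)
import Data.Vec.Membership.DecPropositional as DecMembership
open import Function using (id; _∘_)
open import Relation.Nullary using (¬_; Dec; yes; no; does)
open import Relation.Nullary.Decidable using (dec-true; dec-false)
open import Relation.Binary.Bundles using (Poset; TotalOrder)
open import Relation.Binary.Structures using (IsTotalOrder)
import Relation.Binary.Reasoning.PartialOrder
open import Relation.Binary.PropositionalEquality as ≡ using (_≡_)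
open import Algebra.Bundles using (Semiring)
open import Algebra.Solver.Ring.AlmostCommutativeRing
  using (fromCommutativeRing; _-Raw-AlmostCommutative⟶_)

module OrderedFieldSolver {c ℓ₁ ℓ₂ : Level} (F : OrderedField c ℓ₁ ℓ₂) where

  open OrderedField F public hiding (_≤_)
  open import Algebra.Properties.Ring ring using (-‿distribˡ-*; -‿distribʳ-*; -‿involutive; -0#≈0#)
  open import Algebra.Properties.AbelianGroup +-abelianGroup using (⁻¹-∙-comm)
  open import Algebra.Properties.CommutativeSemigroup +-commutativeSemigroup
    using () renaming (interchange to +-interchange)
  open import Relation.Binary.Reasoning.Setoid setoid

  fromℕ-+ : ∀ m n → fromℕ (m ℕ.+ n) ≈ fromℕ m + fromℕ n
  fromℕ-+ zero    n = sym (+-identityˡ _)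
  fromℕ-+ (suc m) n = trans (+-congˡ (fromℕ-+ m n)) (sym (+-assoc _ _ _))

  fromℕ-* : ∀ m n → fromℕ (m ℕ.* n) ≈ fromℕ m * fromℕ n
  fromℕ-* zero    n = sym (zeroˡ _)
  fromℕ-* (suc m) n = begin
    fromℕ (n ℕ.+ m ℕ.* n)            ≈⟨ fromℕ-+ n (m ℕ.* n) ⟩
    fromℕ n + fromℕ (m ℕ.* n)        ≈⟨ +-cong (sym (*-identityˡ _)) (fromℕ-* m n) ⟩
    1# * fromℕ n + fromℕ m * fromℕ n ≈⟨ distribʳ _ _ _ ⟨
    (1# + fromℕ m) * fromℕ n         ∎

  -- Numerals as the ring solver reads them: lit 1 is 1# itself, whereas
  -- fromℕ 1 is 1# + 0#, which the solver cannot match against 1#.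
  lit : ℕ → Carrier
  lit zero          = 0#
  lit (suc zero)    = 1#
  lit (suc (suc n)) = 1# + lit (suc n)

  lit≈fromℕ : ∀ n → lit n ≈ fromℕ n
  lit≈fromℕ zero          = refl
  lit≈fromℕ (suc zero)    = sym (+-identityʳ 1#)
  lit≈fromℕ (suc (suc n)) = +-congˡ (lit≈fromℕ (suc n))

  lit-suc : ∀ n → lit (suc n) ≈ 1# + lit n
  lit-suc n = trans (lit≈fromℕ (suc n)) (+-congˡ (sym (lit≈fromℕ n)))

  lit-+ : ∀ m n → lit (m ℕ.+ n) ≈ lit m + lit n
  lit-+ m n = trans (lit≈fromℕ (m ℕ.+ n))
    (trans (fromℕ-+ m n) (sym (+-cong (lit≈fromℕ m) (lit≈fromℕ n))))

  lit-* : ∀ m n → lit (m ℕ.* n) ≈ lit m * lit n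
  lit-* m n = trans (lit≈fromℕ (m ℕ.* n))
    (trans (fromℕ-* m n) (sym (*-cong (lit≈fromℕ m) (lit≈fromℕ n))))

  fromℤ : ℤ → Carrier
  fromℤ (+ n)    = lit n
  fromℤ -[1+ n ] = - lit (suc n)

  fromℤ-⊖ : ∀ m n → fromℤ (m ℤ.⊖ n) ≈ lit m - lit n
  fromℤ-⊖ zero    zero    = sym (-‿inverseʳ 0#)
  fromℤ-⊖ zero    (suc n) = sym (+-identityˡ _)
  fromℤ-⊖ (suc m) zero    = sym (trans (+-congˡ -0#≈0#) (+-identityʳ _))
  fromℤ-⊖ (suc m) (suc n) rewrite ℤₚ.[1+m]⊖[1+n]≡m⊖n m n = begin
    fromℤ (m ℤ.⊖ n)                ≈⟨ fromℤ-⊖ m n ⟩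
    lit m - lit n                  ≈⟨ +-identityˡ _ ⟨
    0# + (lit m - lit n)           ≈⟨ +-congʳ (-‿inverseʳ 1#) ⟨
    (1# - 1#) + (lit m - lit n)    ≈⟨ +-interchange _ _ _ _ ⟩
    (1# + lit m) + (- 1# - lit n)  ≈⟨ +-congˡ (⁻¹-∙-comm 1# (lit n)) ⟩
    (1# + lit m) - (1# + lit n)    ≈⟨ +-cong (lit-suc m) (-‿cong (lit-suc n)) ⟨
    lit (suc m) - lit (suc n)      ∎

  fromℤ-+ : ∀ i j → fromℤ (i ℤ.+ j) ≈ fromℤ i + fromℤ j
  fromℤ-+ -[1+ m ] -[1+ n ] = begin
    - lit (suc (suc (m ℕ.+ n)))      ≈⟨ -‿cong (reflexive (≡.cong lit (≡.sym (ℕₚ.+-suc (suc m) n)))) ⟩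
    - lit (suc m ℕ.+ suc n)          ≈⟨ -‿cong (lit-+ (suc m) (suc n)) ⟩
    - (lit (suc m) + lit (suc n))    ≈⟨ ⁻¹-∙-comm _ _ ⟨
    - lit (suc m) - lit (suc n)      ∎
  fromℤ-+ -[1+ m ] (+ n)    = trans (fromℤ-⊖ n (suc m)) (+-comm _ _)
  fromℤ-+ (+ m)    -[1+ n ] = fromℤ-⊖ m (suc n)
  fromℤ-+ (+ m)    (+ n)    = lit-+ m n

  fromℤ-neg : ∀ i → fromℤ (ℤ.- i) ≈ - fromℤ i
  fromℤ-neg -[1+ n ]    = sym (-‿involutive _)
  fromℤ-neg (+ zero)    = sym -0#≈0#
  fromℤ-neg (+ suc n)   = refl

  signed : Sign → Carrier → Carrier
  signed Sign.+ x = x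
  signed Sign.- x = - x

  signed-cong : ∀ s {x y} → x ≈ y → signed s x ≈ signed s y
  signed-cong Sign.+ x≈y = x≈y
  signed-cong Sign.- x≈y = -‿cong x≈y

  signed-* : ∀ s t x y → signed (s Sign.* t) (x * y) ≈ signed s x * signed t y
  signed-* Sign.+ Sign.+ x y = refl
  signed-* Sign.+ Sign.- x y = -‿distribʳ-* x y
  signed-* Sign.- Sign.+ x y = -‿distribˡ-* x y
  signed-* Sign.- Sign.- x y = begin
    x * y           ≈⟨ -‿involutive _ ⟨
    - - (x * y)     ≈⟨ -‿cong (-‿distribʳ-* x y) ⟩
    - (x * - y)     ≈⟨ -‿distribˡ-* x (- y) ⟩
    - x * - y       ∎

  fromℤ-◃ : ∀ s n → fromℤ (s ℤ.◃ n) ≈ signed s (lit n)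
  fromℤ-◃ Sign.+ zero    = refl
  fromℤ-◃ Sign.- zero    = sym -0#≈0#
  fromℤ-◃ Sign.+ (suc n) = refl
  fromℤ-◃ Sign.- (suc n) = refl

  fromℤ-signAbs : ∀ i → fromℤ i ≈ signed (ℤ.sign i) (lit ℤ.∣ i ∣)
  fromℤ-signAbs (+ n)    = refl
  fromℤ-signAbs -[1+ n ] = refl

  fromℤ-* : ∀ i j → fromℤ (i ℤ.* j) ≈ fromℤ i * fromℤ j
  fromℤ-* i j = begin
    fromℤ (ℤ.sign i Sign.* ℤ.sign j ℤ.◃ ℤ.∣ i ∣ ℕ.* ℤ.∣ j ∣)
      ≈⟨ fromℤ-◃ _ (ℤ.∣ i ∣ ℕ.* ℤ.∣ j ∣) ⟩
    signed (ℤ.sign i Sign.* ℤ.sign j) (lit (ℤ.∣ i ∣ ℕ.* ℤ.∣ j ∣))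
      ≈⟨ signed-cong (ℤ.sign i Sign.* ℤ.sign j) (lit-* ℤ.∣ i ∣ ℤ.∣ j ∣) ⟩
    signed (ℤ.sign i Sign.* ℤ.sign j) (lit ℤ.∣ i ∣ * lit ℤ.∣ j ∣)
      ≈⟨ signed-* (ℤ.sign i) (ℤ.sign j) _ _ ⟩
    signed (ℤ.sign i) (lit ℤ.∣ i ∣) * signed (ℤ.sign j) (lit ℤ.∣ j ∣)
      ≈⟨ *-cong (fromℤ-signAbs i) (fromℤ-signAbs j) ⟨
    fromℤ i * fromℤ j
      ∎

  fromℤ-morphism : ℤ.+-*-rawRing -Raw-AlmostCommutative⟶ fromCommutativeRing commutativeRing
  fromℤ-morphism = record
    { ⟦_⟧    = fromℤ
    ; +-homo = fromℤ-+
    ; *-homo = fromℤ-*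
    ; -‿homo = fromℤ-neg
    ; 0-homo = refl
    ; 1-homo = refl
    }

  coefficients≟ : ∀ i j → Maybe (fromℤ i ≈ fromℤ j)
  coefficients≟ i j with i ℤ.≟ j
  ... | yes ≡.refl = just refl
  ... | no _       = nothing

  open import Algebra.Solver.Ring ℤ.+-*-rawRing (fromCommutativeRing commutativeRing)
    fromℤ-morphism coefficients≟ public
    using (solve; _:=_; _:+_; _:*_; _:-_; :-_; con)

module OrderedFieldProperties {c ℓ₁ ℓ₂ : Level} (F : OrderedField c ℓ₁ ℓ₂) where

  open OrderedFieldSolver F public
  open import Algebra.Properties.Ring ring using (-0#≈0#)

  -- The field _≤_ has no fixity declaration; this alias has the usual one.
  infix 4 _≤_
  _≤_ : Carrier → Carrier → Set ℓ₂
  _≤_ = OrderedField._≤_ F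

  open IsTotalOrder isTotalOrder public
    using (total; antisym; ≤-respˡ-≈; ≤-respʳ-≈)
    renaming (refl to ≤-refl; trans to ≤-trans; reflexive to ≤-reflexive)

  ≤-poset : Poset c ℓ₁ ℓ₂
  ≤-poset = record { isPartialOrder = IsTotalOrder.isPartialOrder isTotalOrder }

  module ≤-Reasoning = Relation.Binary.Reasoning.PartialOrder ≤-poset

  ≤-totalOrder : TotalOrder c ℓ₁ ℓ₂
  ≤-totalOrder = record { isTotalOrder = isTotalOrder }

  open import Algebra.Construct.NaturalChoice.Min ≤-totalOrder public
    using (_⊓_; x⊓y≤y; x≤y⇒x⊓y≈x; x≤y⇒y⊓x≈x; ⊓-mono-≤; ⊓-idem)

  +-monoʳ-≤ : ∀ {x y} z → x ≤ y → z + x ≤ z + y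
  +-monoʳ-≤ {x} {y} z x≤y = ≤-respˡ-≈ (+-comm x z) (≤-respʳ-≈ (+-comm y z) (+-monoˡ-≤ z x≤y))

  +-mono-≤ : ∀ {x y u v} → x ≤ y → u ≤ v → x + u ≤ y + v
  +-mono-≤ x≤y u≤v = ≤-trans (+-monoˡ-≤ _ x≤y) (+-monoʳ-≤ _ u≤v)

  +-nonNeg : ∀ {x y} → 0# ≤ x → 0# ≤ y → 0# ≤ x + y
  +-nonNeg 0≤x 0≤y = ≤-respˡ-≈ (+-identityʳ 0#) (+-mono-≤ 0≤x 0≤y)

  x≤y⇒0≤y-x : ∀ {x y} → x ≤ y → 0# ≤ y - x
  x≤y⇒0≤y-x {x} x≤y = ≤-respˡ-≈ (-‿inverseʳ x) (+-monoˡ-≤ (- x) x≤y)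

  -- Most inequalities below are proved by having the solver rewrite y - x
  -- as a manifestly nonnegative expression.
  ≤-fromDifference : ∀ {x y z} → y - x ≈ z → 0# ≤ z → x ≤ y
  ≤-fromDifference {x} {y} y-x≈z 0≤z =
    ≤-respˡ-≈ (+-identityˡ x) (≤-respʳ-≈ y-x+x≈y (+-monoˡ-≤ x (≤-respʳ-≈ (sym y-x≈z) 0≤z)))
    where
    y-x+x≈y : y - x + x ≈ y
    y-x+x≈y = solve 2 (λ x y → y :- x :+ x := y) refl x y

  *-monoˡ-≤-nonNeg : ∀ {x y} z → 0# ≤ z → x ≤ y → z * x ≤ z * y
  *-monoˡ-≤-nonNeg {x} {y} z 0≤z x≤y = ≤-fromDifference
    (solve 3 (λ x y z → z :* y :- z :* x := z :* (y :- x)) refl x y z)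
    (*-nonneg 0≤z (x≤y⇒0≤y-x x≤y))

  *-monoʳ-≤-nonNeg : ∀ {x y} z → 0# ≤ z → x ≤ y → x * z ≤ y * z
  *-monoʳ-≤-nonNeg {x} {y} z 0≤z x≤y =
    ≤-respˡ-≈ (*-comm z x) (≤-respʳ-≈ (*-comm z y) (*-monoˡ-≤-nonNeg z 0≤z x≤y))

  *-mono-≤-nonNeg : ∀ {x y u v} → 0# ≤ x → x ≤ y → 0# ≤ u → u ≤ v → x * u ≤ y * v
  *-mono-≤-nonNeg 0≤x x≤y 0≤u u≤v =
    ≤-trans (*-monoʳ-≤-nonNeg _ 0≤u x≤y) (*-monoˡ-≤-nonNeg _ (≤-trans 0≤x x≤y) u≤v)

  neg-antimono-≤ : ∀ {x y} → x ≤ y → - y ≤ - x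
  neg-antimono-≤ {x} {y} x≤y =
    ≤-fromDifference (solve 2 (λ x y → :- x :- :- y := y :- x) refl x y) (x≤y⇒0≤y-x x≤y)

  x-nonNeg≤x : ∀ {x y} → 0# ≤ y → x - y ≤ x
  x-nonNeg≤x {x} {y} 0≤y = ≤-fromDifference (solve 2 (λ x y → x :- (x :- y) := y) refl x y) 0≤y

  x≤x+nonNeg : ∀ {x y} → 0# ≤ y → x ≤ x + y
  x≤x+nonNeg {x} 0≤y = ≤-respˡ-≈ (+-identityʳ x) (+-monoʳ-≤ x 0≤y)

  square-nonNeg : ∀ x → 0# ≤ x * x
  square-nonNeg x with total 0# x
  ... | inj₁ 0≤x = *-nonneg 0≤x 0≤x
  ... | inj₂ x≤0 = ≤-respʳ-≈ (solve 1 (λ x → (:- x) :* (:- x) := x :* x) refl x) (*-nonneg 0≤-x 0≤-x)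
    where
    0≤-x : 0# ≤ - x
    0≤-x = ≤-respˡ-≈ -0#≈0# (neg-antimono-≤ x≤0)

  0≤1 : 0# ≤ 1#
  0≤1 = ≤-respʳ-≈ (*-identityʳ 1#) (square-nonNeg 1#)

  fromℕ-nonNeg : ∀ k → 0# ≤ fromℕ k
  fromℕ-nonNeg zero    = ≤-refl
  fromℕ-nonNeg (suc k) = +-nonNeg 0≤1 (fromℕ-nonNeg k)

  fromℕ-suc≉0 : ∀ k → ¬ (fromℕ (suc k) ≈ 0#)
  fromℕ-suc≉0 k 1+k≈0 = nontrivial (antisym 0≤1 (≤-respʳ-≈ 1+k≈0 (x≤x+nonNeg (fromℕ-nonNeg k))))

  *-cancelˡ-≤-pos : ∀ {x y} z → 0# ≤ z → ¬ (z ≈ 0#) → z * x ≤ z * y → x ≤ y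
  *-cancelˡ-≤-pos {x} {y} z 0≤z z≉0 zx≤zy with total x y | inverse z z≉0
  ... | inj₁ x≤y | _             = x≤y
  ... | inj₂ y≤x | z⁻¹ , z*z⁻¹≈1 = ≤-reflexive (begin-equality
    x                   ≈⟨ *-identityˡ x ⟨
    1# * x              ≈⟨ *-congʳ z*z⁻¹≈1 ⟨
    (z * z⁻¹) * x       ≈⟨ solve 3 (λ x z w → (z :* w) :* x := w :* (z :* x)) refl x z z⁻¹ ⟩
    z⁻¹ * (z * x)       ≈⟨ *-congˡ (antisym zx≤zy (*-monoˡ-≤-nonNeg z 0≤z y≤x)) ⟩
    z⁻¹ * (z * y)       ≈⟨ solve 3 (λ y z w → w :* (z :* y) := (z :* w) :* y) refl y z z⁻¹ ⟩
    (z * z⁻¹) * y       ≈⟨ *-congʳ z*z⁻¹≈1 ⟩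
    1# * y              ≈⟨ *-identityˡ y ⟩
    y                   ∎)
    where open ≤-Reasoning

  lit-nonNeg : ∀ k → 0# ≤ lit k
  lit-nonNeg k = ≤-respʳ-≈ (sym (lit≈fromℕ k)) (fromℕ-nonNeg k)

  lit-suc≉0 : ∀ k → ¬ (lit (suc k) ≈ 0#)
  lit-suc≉0 k lit≈0 = fromℕ-suc≉0 k (trans (sym (lit≈fromℕ (suc k))) lit≈0)

  inverse-nonNeg : ∀ {x y} → 0# ≤ x → x * y ≈ 1# → 0# ≤ y
  inverse-nonNeg {x} {y} 0≤x xy≈1 = [ id , y≤0⇒ ]′ (total 0# y)
    where
    y≤0⇒ : y ≤ 0# → 0# ≤ y
    y≤0⇒ y≤0 = ⊥-elim (nontrivial (antisym 0≤1
      (≤-respˡ-≈ xy≈1 (≤-respʳ-≈ (zeroʳ x) (*-monoˡ-≤-nonNeg x 0≤x y≤0)))))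

  fromℕ-nonZero≉0 : ∀ n → .{{NonZero n}} → ¬ (fromℕ n ≈ 0#)
  fromℕ-nonZero≉0 (suc n) = fromℕ-suc≉0 n

  open import Algebra.Definitions.RawSemiring (Semiring.rawSemiring semiring) public using (_^_)
  open import Algebra.Properties.Semiring.Exp semiring using (^-homo-*)

  ^-nonNeg : ∀ {x} k → 0# ≤ x → 0# ≤ x ^ k
  ^-nonNeg zero    0≤x = 0≤1
  ^-nonNeg (suc k) 0≤x = *-nonneg 0≤x (^-nonNeg k 0≤x)

  ^-≤1 : ∀ {x} k → 0# ≤ x → x ≤ 1# → x ^ k ≤ 1#
  ^-≤1 zero    0≤x x≤1 = ≤-refl
  ^-≤1 (suc k) 0≤x x≤1 = ≤-respʳ-≈ (*-identityʳ 1#) (*-mono-≤-nonNeg 0≤x x≤1 (^-nonNeg k 0≤x) (^-≤1 k 0≤x x≤1))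

  ^-antitone : ∀ {x} i j → 0# ≤ x → x ≤ 1# → i ℕ.≤ j → x ^ j ≤ x ^ i
  ^-antitone {x} i j 0≤x x≤1 i≤j = begin
    x ^ j                  ≡⟨ ≡.cong (x ^_) (≡.sym (ℕₚ.m+[n∸m]≡n i≤j)) ⟩
    x ^ (i ℕ.+ (j ℕ.∸ i))  ≈⟨ ^-homo-* x i (j ℕ.∸ i) ⟩
    x ^ i * x ^ (j ℕ.∸ i)  ≤⟨ *-monoˡ-≤-nonNeg _ (^-nonNeg i 0≤x) (^-≤1 (j ℕ.∸ i) 0≤x x≤1) ⟩
    x ^ i * 1#             ≈⟨ *-identityʳ _ ⟩
    x ^ i                  ∎
    where open ≤-Reasoning

module BigOperators {c ℓ₁ ℓ₂ : Level} (F : OrderedField c ℓ₁ ℓ₂) where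

  open OrderedFieldProperties F
  open ≤-Reasoning

  sumFin-cong : ∀ k {f g : Fin k → Carrier} → (∀ i → f i ≈ g i) → sumFin k f ≈ sumFin k g
  sumFin-cong zero    f≈g = refl
  sumFin-cong (suc k) f≈g = +-cong (f≈g Fin.zero) (sumFin-cong k (λ i → f≈g (Fin.suc i)))

  sumFin-mono-≤ : ∀ k {f g : Fin k → Carrier} → (∀ i → f i ≤ g i) → sumFin k f ≤ sumFin k g
  sumFin-mono-≤ zero    f≤g = ≤-refl
  sumFin-mono-≤ (suc k) f≤g = +-mono-≤ (f≤g Fin.zero) (sumFin-mono-≤ k (λ i → f≤g (Fin.suc i)))

  sumFin-nonNeg : ∀ k {f : Fin k → Carrier} → (∀ i → 0# ≤ f i) → 0# ≤ sumFin k f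
  sumFin-nonNeg zero    0≤f = ≤-refl
  sumFin-nonNeg (suc k) 0≤f = +-nonNeg (0≤f Fin.zero) (sumFin-nonNeg k (λ i → 0≤f (Fin.suc i)))

  sumFin-+ : ∀ k (f g : Fin k → Carrier) → sumFin k (λ i → f i + g i) ≈ sumFin k f + sumFin k g
  sumFin-+ zero    f g = sym (+-identityˡ 0#)
  sumFin-+ (suc k) f g = trans (+-congˡ (sumFin-+ k _ _))
    (solve 4 (λ a b c d → (a :+ b) :+ (c :+ d) := (a :+ c) :+ (b :+ d)) refl _ _ _ _)

  sumFin-*ˡ : ∀ k a (f : Fin k → Carrier) → sumFin k (λ i → a * f i) ≈ a * sumFin k f
  sumFin-*ˡ zero    a f = sym (zeroʳ a)
  sumFin-*ˡ (suc k) a f = trans (+-congˡ (sumFin-*ˡ k a _)) (sym (distribˡ _ _ _))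

  sumFin-const : ∀ k x → sumFin k (λ _ → x) ≈ fromℕ k * x
  sumFin-const zero    x = sym (zeroˡ x)
  sumFin-const (suc k) x = begin-equality
    x + sumFin k (λ _ → x)   ≈⟨ +-cong (sym (*-identityˡ x)) (sumFin-const k x) ⟩
    1# * x + fromℕ k * x     ≈⟨ distribʳ x 1# (fromℕ k) ⟨
    (1# + fromℕ k) * x       ∎

  sumFin-neg : ∀ k (f : Fin k → Carrier) → sumFin k (λ i → - f i) ≈ - sumFin k f
  sumFin-neg k f = begin-equality
    sumFin k (λ i → - f i)       ≈⟨ sumFin-cong k (λ i → solve 1 (λ x → :- x := (:- con (+ 1)) :* x) refl (f i)) ⟩
    sumFin k (λ i → - 1# * f i)  ≈⟨ sumFin-*ˡ k (- 1#) f ⟩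
    - 1# * sumFin k f            ≈⟨ solve 1 (λ x → (:- con (+ 1)) :* x := :- x) refl _ ⟩
    - sumFin k f                 ∎

  sumFin-affine : ∀ k a b (f : Fin k → Carrier) → sumFin k (λ i → a * f i - b) ≈ a * sumFin k f - fromℕ k * b
  sumFin-affine k a b f = begin-equality
    sumFin k (λ i → a * f i - b)                      ≈⟨ sumFin-+ k _ _ ⟩
    sumFin k (λ i → a * f i) + sumFin k (λ _ → - b)   ≈⟨ +-cong (sumFin-*ˡ k a f) (sumFin-const k (- b)) ⟩
    a * sumFin k f + fromℕ k * - b                    ≈⟨ +-congˡ (-‿distribʳ-* (fromℕ k) b) ⟨
    a * sumFin k f - fromℕ k * b                      ∎
    where open import Algebra.Properties.Ring ring using (-‿distribʳ-*)

  term≤sumFin : ∀ k {f : Fin k → Carrier} → (∀ i → 0# ≤ f i) → ∀ j → f j ≤ sumFin k f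
  term≤sumFin (suc k) 0≤f Fin.zero    = x≤x+nonNeg (sumFin-nonNeg k (λ i → 0≤f (Fin.suc i)))
  term≤sumFin (suc k) 0≤f (Fin.suc j) = ≤-trans (term≤sumFin k (λ i → 0≤f (Fin.suc i)) j)
    (≤-respˡ-≈ (+-identityˡ _) (+-monoˡ-≤ _ (0≤f Fin.zero)))

  sumFin-last : ∀ k (f : Fin (suc k) → Carrier) →
                sumFin (suc k) f ≈ sumFin k (λ i → f (inject₁ i)) + f (Fin.fromℕ k)
  sumFin-last zero    f = +-comm _ _
  sumFin-last (suc k) f = trans (+-congˡ (sumFin-last k (λ i → f (Fin.suc i)))) (sym (+-assoc _ _ _))

  IsDistribution⇒≤1 : ∀ {k} {p : Fin k → Carrier} → IsDistribution p → ∀ i → p i ≤ 1#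
  IsDistribution⇒≤1 {k} (0≤p , Σp≈1) i = ≤-respʳ-≈ Σp≈1 (term≤sumFin k 0≤p i)

  sumFin-inject₁≤1 : ∀ {n} {p : Fin (suc n) → Carrier} → IsDistribution p → sumFin n (λ i → p (inject₁ i)) ≤ 1#
  sumFin-inject₁≤1 {n} {p} (0≤p , Σp≈1) =
    ≤-trans (x≤x+nonNeg (0≤p (Fin.fromℕ n))) (≤-reflexive (trans (sym (sumFin-last n p)) Σp≈1))

  prodFin : ∀ k → (Fin k → Carrier) → Carrier
  prodFin zero    f = 1#
  prodFin (suc k) f = f Fin.zero * prodFin k (λ i → f (Fin.suc i))

  prodFin-cong : ∀ k {f g : Fin k → Carrier} → (∀ i → f i ≈ g i) → prodFin k f ≈ prodFin k g
  prodFin-cong zero    f≈g = refl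
  prodFin-cong (suc k) f≈g = *-cong (f≈g Fin.zero) (prodFin-cong k (λ i → f≈g (Fin.suc i)))

  prodFin-1 : ∀ k → prodFin k (λ _ → 1#) ≈ 1#
  prodFin-1 zero    = refl
  prodFin-1 (suc k) = trans (*-identityˡ _) (prodFin-1 k)

  prodFin-nonNeg : ∀ k {f : Fin k → Carrier} → (∀ i → 0# ≤ f i) → 0# ≤ prodFin k f
  prodFin-nonNeg zero    0≤f = 0≤1
  prodFin-nonNeg (suc k) 0≤f = *-nonneg (0≤f Fin.zero) (prodFin-nonNeg k (λ i → 0≤f (Fin.suc i)))

  prodFin-≤1 : ∀ k {f : Fin k → Carrier} → (∀ i → 0# ≤ f i) → (∀ i → f i ≤ 1#) → prodFin k f ≤ 1#
  prodFin-≤1 zero    0≤f f≤1 = ≤-refl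
  prodFin-≤1 (suc k) 0≤f f≤1 = ≤-respʳ-≈ (*-identityʳ 1#)
    (*-mono-≤-nonNeg (0≤f Fin.zero) (f≤1 Fin.zero) (prodFin-nonNeg k (λ i → 0≤f (Fin.suc i)))
                     (prodFin-≤1 k (λ i → 0≤f (Fin.suc i)) (λ i → f≤1 (Fin.suc i))))

  prodFin-* : ∀ k (f g : Fin k → Carrier) → prodFin k (λ i → f i * g i) ≈ prodFin k f * prodFin k g
  prodFin-* zero    f g = sym (*-identityˡ 1#)
  prodFin-* (suc k) f g = trans (*-congˡ (prodFin-* k _ _))
    (solve 4 (λ a b c d → (a :* b) :* (c :* d) := (a :* c) :* (b :* d)) refl _ _ _ _)

  prodFin-last : ∀ k (f : Fin (suc k) → Carrier) →
                 prodFin (suc k) f ≈ prodFin k (λ i → f (inject₁ i)) * f (Fin.fromℕ k)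
  prodFin-last zero    f = *-comm _ _
  prodFin-last (suc k) f = trans (*-congˡ (prodFin-last k (λ i → f (Fin.suc i)))) (sym (*-assoc _ _ _))

  1+sumFin≤prodFin-1+ : ∀ k (t : Fin k → Carrier) → (∀ i → 0# ≤ t i) →
                        1# + sumFin k t ≤ prodFin k (λ i → 1# + t i)
  1+sumFin≤prodFin-1+ zero    t 0≤t = ≤-reflexive (+-identityʳ 1#)
  1+sumFin≤prodFin-1+ (suc k) t 0≤t = begin
    1# + (t₀ + T)          ≈⟨ solve 2 (λ a s → con (+ 1) :+ (a :+ s) := (con (+ 1) :+ a) :* (con (+ 1) :+ s) :- a :* s) refl t₀ T ⟩
    (1# + t₀) * (1# + T) - t₀ * T
                           ≤⟨ x-nonNeg≤x (*-nonneg (0≤t Fin.zero) (sumFin-nonNeg k (λ i → 0≤t (Fin.suc i)))) ⟩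
    (1# + t₀) * (1# + T)   ≤⟨ *-monoˡ-≤-nonNeg _ (+-nonNeg 0≤1 (0≤t Fin.zero))
                                (1+sumFin≤prodFin-1+ k _ (λ i → 0≤t (Fin.suc i))) ⟩
    (1# + t₀) * prodFin k (λ i → 1# + t (Fin.suc i)) ∎
    where
    t₀ = t Fin.zero
    T  = sumFin k (λ i → t (Fin.suc i))

module DistinctProducts {c ℓ₁ ℓ₂ : Level} (F : OrderedField c ℓ₁ ℓ₂) where

  open OrderedFieldProperties F
  open BigOperators F
  open ≤-Reasoning

  if-yes : ∀ {a} {A : Set a} (d : Dec A) → A → ∀ {x y} → (if does d then x else y) ≈ x
  if-yes d a rewrite dec-true d a = refl

  if-no : ∀ {a} {A : Set a} (d : Dec A) → ¬ A → ∀ {x y} → (if does d then x else y) ≈ y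
  if-no d ¬a rewrite dec-false d ¬a = refl

  if-same : ∀ b {x} → (if b then x else x) ≈ x
  if-same true  = refl
  if-same false = refl

  infixl 9 _[_]≔1
  _[_]≔1 : ∀ {k} → (Fin k → Carrier) → Fin k → Fin k → Carrier
  (f [ x ]≔1) i = if does (i ≟ x) then 1# else f i

  []≔1-nonNeg : ∀ {k} {f : Fin k → Carrier} → (∀ i → 0# ≤ f i) → ∀ x i → 0# ≤ (f [ x ]≔1) i
  []≔1-nonNeg 0≤f x i with does (i ≟ x)
  ... | true  = 0≤1
  ... | false = 0≤f i

  prodFin-extract : ∀ k (f : Fin k → Carrier) x → prodFin k f ≈ f x * prodFin k (f [ x ]≔1)
  prodFin-extract (suc k) f Fin.zero    = *-congˡ (sym (*-identityˡ _))
  prodFin-extract (suc k) f (Fin.suc j) = begin-equality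
    f₀ * prodFin k f'                     ≈⟨ *-congˡ (prodFin-extract k f' j) ⟩
    f₀ * (f' j * prodFin k (f' [ j ]≔1))  ≈⟨ solve 3 (λ a b c → a :* (b :* c) := b :* (a :* c)) refl _ _ _ ⟩
    f' j * (f₀ * prodFin k (f' [ j ]≔1))  ∎
    where
    f₀ = f Fin.zero
    f' = λ i → f (Fin.suc i)

  prodDistinct : ∀ {N k} → (Fin N → Carrier) → Vec (Fin N) k → Carrier
  prodDistinct f []      = 1#
  prodDistinct f (x ∷ v) = f x * prodDistinct (f [ x ]≔1) v

  prodDistinct-nonNeg : ∀ {N k} {f : Fin N → Carrier} → (∀ i → 0# ≤ f i) → (v : Vec (Fin N) k) →
                        0# ≤ prodDistinct f v
  prodDistinct-nonNeg 0≤f []      = 0≤1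
  prodDistinct-nonNeg 0≤f (x ∷ v) = *-nonneg (0≤f x) (prodDistinct-nonNeg ([]≔1-nonNeg 0≤f x) v)

  prodDistinct-≈1 : ∀ {N k} {f : Fin N → Carrier} (v : Vec (Fin N) k) →
                    (∀ {x} → x ∈ v → f x ≈ 1#) → prodDistinct f v ≈ 1#
  prodDistinct-≈1         []      _    = refl
  prodDistinct-≈1 {f = f} (x ∷ v) f≈1 =
    trans (*-cong (f≈1 (here ≡.refl)) (prodDistinct-≈1 v f[x]≔1≈1)) (*-identityˡ 1#)
    where
    f[x]≔1≈1 : ∀ {y} → y ∈ v → (f [ x ]≔1) y ≈ 1#
    f[x]≔1≈1 {y} y∈v with y ≟ x
    ... | yes _ = refl
    ... | no  _ = f≈1 (there y∈v)

  module _ {N : ℕ} where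
    open DecMembership (_≟_ {N}) using (_∈?_)

    prodFin-∈≈prodDistinct : ∀ {k} (f : Fin N → Carrier) (v : Vec (Fin N) k) →
                             prodFin N (λ i → if does (i ∈? v) then f i else 1#) ≈ prodDistinct f v
    prodFin-∈≈prodDistinct f []      = prodFin-1 N
    prodFin-∈≈prodDistinct f (x ∷ v) = begin-equality
      prodFin N g                      ≈⟨ prodFin-extract N g x ⟩
      g x * prodFin N (g [ x ]≔1)      ≈⟨ *-cong (if-yes (x ∈? (x ∷ v)) (here ≡.refl)) (prodFin-cong N g[x]≔1≈) ⟩
      f x * prodFin N (λ i → if does (i ∈? v) then (f [ x ]≔1) i else 1#)
                                       ≈⟨ *-congˡ (prodFin-∈≈prodDistinct (f [ x ]≔1) v) ⟩
      f x * prodDistinct (f [ x ]≔1) v ∎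
      where
      g : Fin N → Carrier
      g i = if does (i ∈? (x ∷ v)) then f i else 1#
      g[x]≔1≈ : ∀ i → (g [ x ]≔1) i ≈ (if does (i ∈? v) then (f [ x ]≔1) i else 1#)
      g[x]≔1≈ i with i ≟ x
      ... | yes _ = sym (if-same (does (i ∈? v)))
      ... | no  _ = refl

  prodFin-sub-≥ : ∀ k (a β : Fin k → Carrier) → (∀ i → 0# ≤ β i) → (∀ i → β i ≤ a i) →
                  prodFin k a - sumFin k (λ x → β x * prodFin k (a [ x ]≔1)) ≤ prodFin k (λ i → a i - β i)
  prodFin-sub-≥ zero    a β 0≤β β≤a = ≤-reflexive (solve 1 (λ x → x :- con (+ 0) := x) refl 1#)
  prodFin-sub-≥ (suc k) a β 0≤β β≤a = begin
    a₀ * A - (β₀ * (1# * A) + sumFin k (λ j → β (Fin.suc j) * (a₀ * prodFin k (a' [ j ]≔1))))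
      ≈⟨ +-congˡ (-‿cong (+-cong (*-congˡ (*-identityˡ A))
                                  (trans (sumFin-cong k (λ j → solve 3 (λ b x y → b :* (x :* y) := x :* (b :* y)) refl _ a₀ _))
                                         (sumFin-*ˡ k a₀ _)))) ⟩
    a₀ * A - (β₀ * A + a₀ * T)
      ≈⟨ solve 4 (λ a₀ β₀ A T → a₀ :* A :- (β₀ :* A :+ a₀ :* T) := (a₀ :- β₀) :* (A :- T) :- β₀ :* T)
                 refl a₀ β₀ A T ⟩
    (a₀ - β₀) * (A - T) - β₀ * T
      ≤⟨ x-nonNeg≤x (*-nonneg (0≤β Fin.zero) 0≤T) ⟩
    (a₀ - β₀) * (A - T)
      ≤⟨ *-monoˡ-≤-nonNeg _ (x≤y⇒0≤y-x (β≤a Fin.zero))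
           (prodFin-sub-≥ k a' (λ i → β (Fin.suc i)) (λ i → 0≤β (Fin.suc i)) (λ i → β≤a (Fin.suc i))) ⟩
    (a₀ - β₀) * prodFin k (λ i → a' i - β (Fin.suc i))
      ∎
    where
    a₀ = a Fin.zero
    β₀ = β Fin.zero
    a' = λ i → a (Fin.suc i)
    A  = prodFin k a'
    T  = sumFin k (λ x → β (Fin.suc x) * prodFin k (a' [ x ]≔1))
    0≤a : ∀ i → 0# ≤ a i
    0≤a i = ≤-trans (0≤β i) (β≤a i)
    0≤T : 0# ≤ T
    0≤T = sumFin-nonNeg k (λ x → *-nonneg (0≤β (Fin.suc x))
                                           (prodFin-nonNeg k ([]≔1-nonNeg (λ i → 0≤a (Fin.suc i)) x)))

module Sampling {c ℓ₁ ℓ₂ : Level} (F : OrderedField c ℓ₁ ℓ₂) where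

  open OrderedFieldProperties F
  open BigOperators F
  open DistinctProducts F
  open ≤-Reasoning

  sumSeq-cong : ∀ {N} k {f g : Vec (Fin N) k → Carrier} → (∀ v → f v ≈ g v) → sumSeq k f ≈ sumSeq k g
  sumSeq-cong     zero    f≈g = f≈g []
  sumSeq-cong {N} (suc k) f≈g = sumFin-cong N (λ i → sumSeq-cong k (λ v → f≈g (i ∷ v)))

  sumSeq-mono-≤ : ∀ {N} k {f g : Vec (Fin N) k → Carrier} → (∀ v → f v ≤ g v) → sumSeq k f ≤ sumSeq k g
  sumSeq-mono-≤     zero    f≤g = f≤g []
  sumSeq-mono-≤ {N} (suc k) f≤g = sumFin-mono-≤ N (λ i → sumSeq-mono-≤ k (λ v → f≤g (i ∷ v)))

  sumSeq-*ˡ : ∀ {N} k a (f : Vec (Fin N) k → Carrier) → sumSeq k (λ v → a * f v) ≈ a * sumSeq k f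
  sumSeq-*ˡ     zero    a f = refl
  sumSeq-*ˡ {N} (suc k) a f = trans (sumFin-cong N (λ i → sumSeq-*ˡ k a _)) (sumFin-*ˡ N a _)

  sumSeq-+ : ∀ {N} k (f g : Vec (Fin N) k → Carrier) → sumSeq k (λ v → f v + g v) ≈ sumSeq k f + sumSeq k g
  sumSeq-+     zero    f g = refl
  sumSeq-+ {N} (suc k) f g = trans (sumFin-cong N (λ i → sumSeq-+ k _ _)) (sumFin-+ N _ _)

  sumSeq-neg : ∀ {N} k (f : Vec (Fin N) k → Carrier) → sumSeq k (λ v → - f v) ≈ - sumSeq k f
  sumSeq-neg     zero    f = refl
  sumSeq-neg {N} (suc k) f = trans (sumFin-cong N (λ i → sumSeq-neg k _)) (sumFin-neg N _)

  weight-nonNeg : ∀ {N k} {p : Fin N → Carrier} → (∀ i → 0# ≤ p i) → (v : Vec (Fin N) k) → 0# ≤ weight p v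
  weight-nonNeg 0≤p []      = 0≤1
  weight-nonNeg 0≤p (x ∷ v) = *-nonneg (0≤p x) (weight-nonNeg 0≤p v)

  sumSeq-weight : ∀ {N} k {p : Fin N → Carrier} → sumFin N p ≈ 1# → sumSeq k (weight p) ≈ 1#
  sumSeq-weight     zero    Σp≈1 = refl
  sumSeq-weight {N} (suc k) {p} Σp≈1 = begin-equality
    sumFin N (λ i → sumSeq k (λ v → p i * weight p v)) ≈⟨ sumFin-cong N (λ i → sumSeq-*ˡ k (p i) (weight p)) ⟩
    sumFin N (λ i → p i * sumSeq k (weight p))         ≈⟨ sumFin-cong N (λ i → *-congˡ (sumSeq-weight k Σp≈1)) ⟩
    sumFin N (λ i → p i * 1#)                          ≈⟨ sumFin-cong N (λ i → *-identityʳ (p i)) ⟩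
    sumFin N p                                         ≈⟨ Σp≈1 ⟩
    1#                                                 ∎

  expect : ∀ {N} → (Fin N → Carrier) → ∀ k → (Vec (Fin N) k → Carrier) → Carrier
  expect p k f = sumSeq k (λ v → weight p v * f v)

  expect-cong : ∀ {N} (p : Fin N → Carrier) k {f g : Vec (Fin N) k → Carrier} →
                (∀ v → f v ≈ g v) → expect p k f ≈ expect p k g
  expect-cong p k f≈g = sumSeq-cong k (λ v → *-congˡ (f≈g v))

  expect-mono-≤ : ∀ {N} {p : Fin N → Carrier} → (∀ i → 0# ≤ p i) → ∀ k {f g : Vec (Fin N) k → Carrier} →
                  (∀ v → f v ≤ g v) → expect p k f ≤ expect p k g
  expect-mono-≤ 0≤p k f≤g = sumSeq-mono-≤ k (λ v → *-monoˡ-≤-nonNeg _ (weight-nonNeg 0≤p v) (f≤g v))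

  expect-*ˡ : ∀ {N} (p : Fin N → Carrier) k a (f : Vec (Fin N) k → Carrier) →
              expect p k (λ v → a * f v) ≈ a * expect p k f
  expect-*ˡ p k a f = trans (sumSeq-cong k (λ v → solve 3 (λ w a x → w :* (a :* x) := a :* (w :* x)) refl _ a _))
                            (sumSeq-*ˡ k a _)

  expect-1- : ∀ {N} {p : Fin N → Carrier} → sumFin N p ≈ 1# → ∀ k (f : Vec (Fin N) k → Carrier) →
              expect p k (λ v → 1# - f v) ≈ 1# - expect p k f
  expect-1- {p = p} Σp≈1 k f = begin-equality
    expect p k (λ v → 1# - f v)
      ≈⟨ sumSeq-cong k (λ v → solve 2 (λ w x → w :* (con (+ 1) :- x) := w :+ :- (w :* x)) refl (weight p v) (f v)) ⟩
    sumSeq k (λ v → weight p v + - (weight p v * f v)) ≈⟨ sumSeq-+ k _ _ ⟩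
    sumSeq k (weight p) + sumSeq k (λ v → - (weight p v * f v))
                                                     ≈⟨ +-cong (sumSeq-weight k Σp≈1) (sumSeq-neg k _) ⟩
    1# - expect p k f                                ∎

  expect-suc : ∀ {N} (p : Fin N → Carrier) k (f : Vec (Fin N) (suc k) → Carrier) →
               expect p (suc k) f ≈ sumFin N (λ x → p x * expect p k (λ v → f (x ∷ v)))
  expect-suc {N} p k f = sumFin-cong N (λ x →
    trans (sumSeq-cong k (λ v → *-assoc (p x) (weight p v) (f (x ∷ v)))) (sumSeq-*ˡ k (p x) _))

  -- mix u c is the mean of a quantity that equals 1 with probability u and c otherwise.
  mix : Carrier → Carrier → Carrier
  mix u c = c + (1# - c) * u

  mix-congʳ : ∀ {u c d} → c ≈ d → mix u c ≈ mix u d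
  mix-congʳ c≈d = +-cong c≈d (*-congʳ (+-congˡ (-‿cong c≈d)))

  mix-nonNeg : ∀ {u c} → 0# ≤ u → 0# ≤ c → c ≤ 1# → 0# ≤ mix u c
  mix-nonNeg 0≤u 0≤c c≤1 = +-nonNeg 0≤c (*-nonneg (x≤y⇒0≤y-x c≤1) 0≤u)

  mix-1ˡ : ∀ c → mix 1# c ≈ 1#
  mix-1ˡ c = solve 1 (λ c → c :+ (con (+ 1) :- c) :* con (+ 1) := con (+ 1)) refl c

  mix-1 : ∀ u → mix u 1# ≈ 1#
  mix-1 u = solve 1 (λ u → con (+ 1) :+ (con (+ 1) :- con (+ 1)) :* u := con (+ 1)) refl u

  mix-0 : ∀ u → mix u 0# ≈ u
  mix-0 u = solve 1 (λ u → con (+ 0) :+ (con (+ 1) :- con (+ 0)) :* u := u) refl u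

  mix-comm : ∀ u c → mix u c ≈ mix c u
  mix-comm u c = solve 2 (λ u c → c :+ (con (+ 1) :- c) :* u := u :+ (con (+ 1) :- u) :* c) refl u c

  expect-prodDistinct-≤ : ∀ {N} {p : Fin N → Carrier} → IsDistribution p → ∀ k (f : Fin N → Carrier) →
    (∀ i → 0# ≤ f i) → (∀ i → f i ≤ 1#) →
    expect p k (prodDistinct f) ≤ prodFin N (λ i → mix ((1# - p i) ^ k) (f i))
  expect-prodDistinct-≤ {N} {p} p-dist zero f 0≤f f≤1 = ≤-reflexive (begin-equality
    1# * 1#                         ≈⟨ *-identityˡ 1# ⟩
    1#                              ≈⟨ prodFin-1 N ⟨
    prodFin N (λ _ → 1#)            ≈⟨ prodFin-cong N (λ i → mix-1ˡ (f i)) ⟨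
    prodFin N (λ i → mix 1# (f i))  ∎)
  expect-prodDistinct-≤ {N} {p} p-dist@(0≤p , Σp≈1) (suc k) f 0≤f f≤1 = begin
    expect p (suc k) (prodDistinct f)
      ≈⟨ trans (expect-suc p k (prodDistinct f)) (sumFin-cong N (λ x → *-congˡ (expect-*ˡ p k (f x) _))) ⟩
    sumFin N (λ x → p x * (f x * expect p k (prodDistinct (f [ x ]≔1))))
      ≤⟨ sumFin-mono-≤ N (λ x → *-monoˡ-≤-nonNeg _ (0≤p x) (*-monoˡ-≤-nonNeg _ (0≤f x) (≤-respʳ-≈
           (prodFin-cong N (mix-[]≔1 x))
           (expect-prodDistinct-≤ p-dist k (f [ x ]≔1) ([]≔1-nonNeg 0≤f x) ([]≔1-≤1 x))))) ⟩
    sumFin N (λ x → p x * (f x * prodFin N (a [ x ]≔1)))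
      ≈⟨ Σpf·rest≈Πa-Σβ·rest ⟩
    prodFin N a - sumFin N (λ x → β x * prodFin N (a [ x ]≔1))
      ≤⟨ prodFin-sub-≥ N a β 0≤β β≤a ⟩
    prodFin N (λ i → a i - β i)
      ≈⟨ prodFin-cong N a-β≈mix ⟩
    prodFin N (λ i → mix ((1# - p i) ^ suc k) (f i))
      ∎
    where
    U a β : Fin N → Carrier
    U i = (1# - p i) ^ k
    a i = mix (U i) (f i)
    β i = (1# - f i) * U i * p i
    0≤1-p : ∀ i → 0# ≤ 1# - p i
    0≤1-p i = x≤y⇒0≤y-x (IsDistribution⇒≤1 p-dist i)
    0≤β : ∀ i → 0# ≤ β i
    0≤β i = *-nonneg (*-nonneg (x≤y⇒0≤y-x (f≤1 i)) (^-nonNeg k (0≤1-p i))) (0≤p i)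
    a-β≈mix : ∀ i → a i - β i ≈ mix ((1# - p i) ^ suc k) (f i)
    a-β≈mix i = solve 3 (λ c U q → c :+ (con (+ 1) :- c) :* U :- (con (+ 1) :- c) :* U :* q
                                   := c :+ (con (+ 1) :- c) :* ((con (+ 1) :- q) :* U)) refl (f i) (U i) (p i)
    β≤a : ∀ i → β i ≤ a i
    β≤a i = ≤-fromDifference (a-β≈mix i)
      (mix-nonNeg (*-nonneg (0≤1-p i) (^-nonNeg k (0≤1-p i))) (0≤f i) (f≤1 i))
    []≔1-≤1 : ∀ x i → (f [ x ]≔1) i ≤ 1#
    []≔1-≤1 x i with does (i ≟ x)
    ... | true  = ≤-refl
    ... | false = f≤1 i
    mix-[]≔1 : ∀ x i → mix (U i) ((f [ x ]≔1) i) ≈ (a [ x ]≔1) i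
    mix-[]≔1 x i with does (i ≟ x)
    ... | true  = mix-1 (U i)
    ... | false = refl
    Σpf·rest≈Πa-Σβ·rest : sumFin N (λ x → p x * (f x * prodFin N (a [ x ]≔1)))
                          ≈ prodFin N a - sumFin N (λ x → β x * prodFin N (a [ x ]≔1))
    Σpf·rest≈Πa-Σβ·rest = begin-equality
      sumFin N (λ x → p x * (f x * R x))
        ≈⟨ sumFin-cong N (λ x → solve 4 (λ q c U R → q :* (c :* R)
                                                   := q :* ((c :+ (con (+ 1) :- c) :* U) :* R) :+ :- ((con (+ 1) :- c) :* U :* q :* R))
                                          refl (p x) (f x) (U x) (R x)) ⟩
      sumFin N (λ x → p x * (a x * R x) + - (β x * R x))
        ≈⟨ trans (sumFin-+ N _ _) (+-congˡ (sumFin-neg N _)) ⟩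
      sumFin N (λ x → p x * (a x * R x)) - sumFin N (λ x → β x * R x)
        ≈⟨ +-congʳ (sumFin-cong N (λ x → trans (*-congˡ (sym (prodFin-extract N a x))) (*-comm (p x) _))) ⟩
      sumFin N (λ x → prodFin N a * p x) - sumFin N (λ x → β x * R x)
        ≈⟨ +-congʳ (trans (sumFin-*ˡ N _ p) (trans (*-congˡ Σp≈1) (*-identityʳ _))) ⟩
      prodFin N a - sumFin N (λ x → β x * R x)
        ∎
      where
      R : Fin N → Carrier
      R x = prodFin N (a [ x ]≔1)

module CommonElements {c ℓ₁ ℓ₂ : Level} (F : OrderedField c ℓ₁ ℓ₂) {n : ℕ} where

  open OrderedFieldProperties F
  open BigOperators F
  open DistinctProducts F
  open Sampling F
  open ≤-Reasoning
  open DecMembership (_≟_ {suc n}) using (_∈?_)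

  Prob2≈expect-expect : ∀ {N} m m' (p : Fin N → Carrier) {e} (E : Vec (Fin N) m → Vec (Fin N) m' → Set e) →
    (E? : ∀ s s' → Dec (E s s')) →
    Prob2 m m' p E E? ≈ expect p m (λ s → expect p m' (λ s' → indicator (E? s s')))
  Prob2≈expect-expect m m' p E E? = sumSeq-cong m (λ s →
    trans (sumSeq-cong m' (λ s' → *-assoc _ _ _)) (sumSeq-*ˡ m' _ _))

  Injected : Fin (suc n) → Set
  Injected x = ∃ λ (i : Fin n) → x ≡ inject₁ i

  injected? : ∀ x → Dec (Injected x)
  injected? x = any? (λ i → x ≟ inject₁ i)

  onInjected : (Fin (suc n) → Carrier) → Fin (suc n) → Carrier
  onInjected f x = if does (injected? x) then f x else 1#

  -- prodDistinct (avoid s) s' is 0 if s and s' share a symbol of [n], and 1 otherwise.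
  avoid : ∀ {k} → Vec (Fin (suc n)) k → Fin (suc n) → Carrier
  avoid s x = if does (x ∈? s) then onInjected (λ _ → 0#) x else 1#

  avoid-nonNeg : ∀ {k} (s : Vec (Fin (suc n)) k) x → 0# ≤ avoid s x
  avoid-nonNeg s x with does (x ∈? s) | does (injected? x)
  ... | true  | true  = ≤-refl
  ... | true  | false = 0≤1
  ... | false | _     = 0≤1

  avoid-≤1 : ∀ {k} (s : Vec (Fin (suc n)) k) x → avoid s x ≤ 1#
  avoid-≤1 s x with does (x ∈? s) | does (injected? x)
  ... | true  | true  = 0≤1
  ... | true  | false = ≤-refl
  ... | false | _     = ≤-refl

  1-prodDistinct-avoid≤indicator : ∀ {k k'} (s : Vec (Fin (suc n)) k) (s' : Vec (Fin (suc n)) k') →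
    1# - prodDistinct (avoid s) s' ≤ indicator (commonElement? s s')
  1-prodDistinct-avoid≤indicator s s' with commonElement? s s'
  ... | yes _      = x-nonNeg≤x (prodDistinct-nonNeg (avoid-nonNeg s) s')
  ... | no ¬common = ≤-reflexive (trans (+-congˡ (-‿cong (prodDistinct-≈1 s' avoid≈1))) (-‿inverseʳ 1#))
    where
    avoid≈1 : ∀ {x} → x ∈ s' → avoid s x ≈ 1#
    avoid≈1 {x} x∈s' with x ∈? s | injected? x
    ... | yes x∈s | yes (i , ≡.refl) = ⊥-elim (¬common (i , x∈s , x∈s'))
    ... | yes _   | no _             = refl
    ... | no _    | _                = refl

  module _ {p : Fin (suc n) → Carrier} (p-dist : IsDistribution p) (m m' : ℕ) where

    private
      miss : ℕ → Fin (suc n) → Carrier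
      miss k i = (1# - p i) ^ k

      0≤1-p : ∀ i → 0# ≤ 1# - p i
      0≤1-p i = x≤y⇒0≤y-x (IsDistribution⇒≤1 p-dist i)

      c' : Fin (suc n) → Carrier
      c' = onInjected (miss m')

      0≤c' : ∀ i → 0# ≤ c' i
      0≤c' i with does (injected? i)
      ... | true  = ^-nonNeg m' (0≤1-p i)
      ... | false = 0≤1

      c'≤1 : ∀ i → c' i ≤ 1#
      c'≤1 i with does (injected? i)
      ... | true  = ^-≤1 m' (0≤1-p i) (x-nonNeg≤x (proj₁ p-dist i))
      ... | false = ≤-refl

      mix-avoid : ∀ {k} (s : Vec (Fin (suc n)) k) i →
                  mix (miss m' i) (avoid s i) ≈ (if does (i ∈? s) then c' i else 1#)
      mix-avoid s i with does (i ∈? s) | does (injected? i)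
      ... | true  | true  = mix-0 _
      ... | true  | false = mix-1 _
      ... | false | _     = mix-1 _

      mix-c' : prodFin (suc n) (λ i → mix (miss m i) (c' i))
               ≈ prodFin n (λ j → mix ((1# - p (inject₁ j)) ^ m) ((1# - p (inject₁ j)) ^ m'))
      mix-c' = begin-equality
        prodFin (suc n) (λ i → mix (miss m i) (c' i))
          ≈⟨ prodFin-last n (λ i → mix (miss m i) (c' i)) ⟩
        prodFin n (λ j → mix (miss m (inject₁ j)) (c' (inject₁ j))) * mix (miss m (Fin.fromℕ n)) (c' (Fin.fromℕ n))
          ≈⟨ *-cong (prodFin-cong n (λ j → mix-congʳ (c'-inject₁ j))) (trans (mix-congʳ c'-last) (mix-1 _)) ⟩
        prodFin n (λ j → mix (miss m (inject₁ j)) (miss m' (inject₁ j))) * 1#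
          ≈⟨ *-identityʳ _ ⟩
        prodFin n (λ j → mix (miss m (inject₁ j)) (miss m' (inject₁ j)))
          ∎
        where
        c'-inject₁ : ∀ j → c' (inject₁ j) ≈ miss m' (inject₁ j)
        c'-inject₁ j = if-yes (injected? (inject₁ j)) (j , ≡.refl)
        c'-last : c' (Fin.fromℕ n) ≈ 1#
        c'-last = if-no (injected? (Fin.fromℕ n)) (λ (_ , eq) → fromℕ≢inject₁ eq)

    expect-prodDistinct-avoid-≤ :
      expect p m (λ s → expect p m' (prodDistinct (avoid s)))
        ≤ prodFin n (λ j → mix ((1# - p (inject₁ j)) ^ m) ((1# - p (inject₁ j)) ^ m'))
    expect-prodDistinct-avoid-≤ = begin
      expect p m (λ s → expect p m' (prodDistinct (avoid s)))
        ≤⟨ expect-mono-≤ (proj₁ p-dist) m (λ s → expect-prodDistinct-≤ p-dist m' (avoid s) (avoid-nonNeg s) (avoid-≤1 s)) ⟩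
      expect p m (λ s → prodFin (suc n) (λ i → mix (miss m' i) (avoid s i)))
        ≈⟨ expect-cong p m (λ s → trans (prodFin-cong (suc n) (mix-avoid s)) (prodFin-∈≈prodDistinct c' s)) ⟩
      expect p m (prodDistinct c')
        ≤⟨ expect-prodDistinct-≤ p-dist m c' 0≤c' c'≤1 ⟩
      prodFin (suc n) (λ i → mix (miss m i) (c' i))
        ≈⟨ mix-c' ⟩
      prodFin n (λ j → mix ((1# - p (inject₁ j)) ^ m) ((1# - p (inject₁ j)) ^ m'))
        ∎

    Prob2-common-≥ : 1# - prodFin n (λ j → mix ((1# - p (inject₁ j)) ^ m) ((1# - p (inject₁ j)) ^ m'))
                     ≤ Prob2 m m' p CommonElement commonElement?
    Prob2-common-≥ = begin
      1# - prodFin n (λ j → mix ((1# - p (inject₁ j)) ^ m) ((1# - p (inject₁ j)) ^ m'))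
        ≤⟨ +-monoʳ-≤ 1# (neg-antimono-≤ expect-prodDistinct-avoid-≤) ⟩
      1# - expect p m (λ s → expect p m' (prodDistinct (avoid s)))
        ≈⟨ trans (expect-cong p m (λ s → expect-1- (proj₂ p-dist) m' _)) (expect-1- (proj₂ p-dist) m _) ⟨
      expect p m (λ s → expect p m' (λ s' → 1# - prodDistinct (avoid s) s'))
        ≤⟨ expect-mono-≤ (proj₁ p-dist) m (λ s → expect-mono-≤ (proj₁ p-dist) m' (1-prodDistinct-avoid≤indicator s)) ⟩
      expect p m (λ s → expect p m' (λ s' → indicator (commonElement? s s')))
        ≈⟨ Prob2≈expect-expect m m' p CommonElement commonElement? ⟨
      Prob2 m m' p CommonElement commonElement?
        ∎

module Estimates {c ℓ₁ ℓ₂ : Level} (F : OrderedField c ℓ₁ ℓ₂) where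

  open OrderedFieldProperties F
  open BigOperators F
  open Sampling F using (mix; mix-nonNeg; mix-comm)
  open ≤-Reasoning
  open import Algebra.Properties.Semiring.Exp semiring using (^-congˡ)
  open import Algebra.Properties.CommutativeSemiring.Exp commutativeSemiring using (^-distrib-*)

  fromℕ-pred-nonNeg : ∀ k → 0# ≤ fromℕ k * (fromℕ k - 1#)
  fromℕ-pred-nonNeg zero    = ≤-reflexive (sym (zeroˡ _))
  fromℕ-pred-nonNeg (suc k) = ≤-respʳ-≈ (*-congˡ (solve 1 (λ k → k := con (+ 1) :+ k :- con (+ 1)) refl (fromℕ k)))
                                        (*-nonneg (fromℕ-nonNeg (suc k)) (fromℕ-nonNeg k))

  -- Twice the second-order Taylor polynomial of (1 + q) ^ k at q = 0.
  taylor₂ : ℕ → Carrier → Carrier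
  taylor₂ k q = lit 2 + lit 2 * (fromℕ k * q) + fromℕ k * (fromℕ k - 1#) * (q * q)

  taylor₂≤2[1+q]^k : ∀ {q} → 0# ≤ q → ∀ k → taylor₂ k q ≤ lit 2 * (1# + q) ^ k
  taylor₂≤2[1+q]^k {q} 0≤q zero    = ≤-reflexive
    (solve 1 (λ q → con (+ 2) :+ con (+ 2) :* (con (+ 0) :* q) :+ con (+ 0) :* (con (+ 0) :- con (+ 1)) :* (q :* q)
                    := con (+ 2) :* con (+ 1)) refl q)
  taylor₂≤2[1+q]^k {q} 0≤q (suc k) = begin
    taylor₂ (suc k) q                  ≤⟨ ≤-fromDifference step (*-nonneg (fromℕ-pred-nonNeg k) (*-nonneg 0≤q (*-nonneg 0≤q 0≤q))) ⟩
    (1# + q) * taylor₂ k q             ≤⟨ *-monoˡ-≤-nonNeg _ (+-nonNeg 0≤1 0≤q) (taylor₂≤2[1+q]^k 0≤q k) ⟩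
    (1# + q) * (lit 2 * (1# + q) ^ k)  ≈⟨ solve 3 (λ q P t → (con (+ 1) :+ q) :* (t :* P) := t :* ((con (+ 1) :+ q) :* P))
                                                   refl q ((1# + q) ^ k) (lit 2) ⟩
    lit 2 * (1# + q) ^ suc k           ∎
    where
    step : (1# + q) * taylor₂ k q - taylor₂ (suc k) q ≈ fromℕ k * (fromℕ k - 1#) * (q * (q * q))
    step = solve 2 (λ K q → (con (+ 1) :+ q) :* (con (+ 2) :+ con (+ 2) :* (K :* q) :+ K :* (K :- con (+ 1)) :* (q :* q))
                            :- (con (+ 2) :+ con (+ 2) :* ((con (+ 1) :+ K) :* q)
                                :+ (con (+ 1) :+ K) :* ((con (+ 1) :+ K) :- con (+ 1)) :* (q :* q))
                            := K :* (K :- con (+ 1)) :* (q :* (q :* q))) refl (fromℕ k) q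

  2[1+kq]≤taylor₂ : ∀ k q → lit 2 * (1# + fromℕ k * q) ≤ taylor₂ k q
  2[1+kq]≤taylor₂ k q = ≤-fromDifference
    (solve 2 (λ K q → con (+ 2) :+ con (+ 2) :* (K :* q) :+ K :* (K :- con (+ 1)) :* (q :* q) :- con (+ 2) :* (con (+ 1) :+ K :* q)
                      := K :* (K :- con (+ 1)) :* (q :* q)) refl (fromℕ k) q)
    (*-nonneg (fromℕ-pred-nonNeg k) (square-nonNeg q))

  [1-q]^k*[1+q]^k≤1 : ∀ {q} k → 0# ≤ q → q ≤ 1# → (1# - q) ^ k * (1# + q) ^ k ≤ 1#
  [1-q]^k*[1+q]^k≤1 {q} k 0≤q q≤1 = begin
    (1# - q) ^ k * (1# + q) ^ k  ≈⟨ ^-distrib-* _ _ k ⟨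
    ((1# - q) * (1# + q)) ^ k    ≈⟨ ^-congˡ k (solve 1 (λ q → (con (+ 1) :- q) :* (con (+ 1) :+ q) := con (+ 1) :- q :* q) refl q) ⟩
    (1# - q * q) ^ k             ≤⟨ ^-≤1 k (x≤y⇒0≤y-x q²≤1) (x-nonNeg≤x (square-nonNeg q)) ⟩
    1#                           ∎
    where
    q²≤1 : q * q ≤ 1#
    q²≤1 = ≤-respʳ-≈ (*-identityʳ 1#) (*-mono-≤-nonNeg 0≤q q≤1 0≤q q≤1)

  [1-q]^k*taylor₂≤2 : ∀ {q} k → 0# ≤ q → q ≤ 1# → (1# - q) ^ k * taylor₂ k q ≤ lit 2
  [1-q]^k*taylor₂≤2 {q} k 0≤q q≤1 = begin
    (1# - q) ^ k * taylor₂ k q             ≤⟨ *-monoˡ-≤-nonNeg _ (^-nonNeg k (x≤y⇒0≤y-x q≤1)) (taylor₂≤2[1+q]^k 0≤q k) ⟩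
    (1# - q) ^ k * (lit 2 * (1# + q) ^ k)  ≈⟨ solve 3 (λ a b t → a :* (t :* b) := t :* (a :* b)) refl _ _ (lit 2) ⟩
    lit 2 * ((1# - q) ^ k * (1# + q) ^ k)  ≤⟨ *-monoˡ-≤-nonNeg (lit 2) (lit-nonNeg 2) ([1-q]^k*[1+q]^k≤1 k 0≤q q≤1) ⟩
    lit 2 * 1#                             ≈⟨ *-identityʳ _ ⟩
    lit 2                                  ∎

  [1-q]^k*[1+kq]≤1 : ∀ {q} k → 0# ≤ q → q ≤ 1# → (1# - q) ^ k * (1# + fromℕ k * q) ≤ 1#
  [1-q]^k*[1+kq]≤1 {q} k 0≤q q≤1 = *-cancelˡ-≤-pos (lit 2) (lit-nonNeg 2) (lit-suc≉0 1) (begin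
    lit 2 * ((1# - q) ^ k * (1# + fromℕ k * q))  ≈⟨ solve 3 (λ a x t → t :* (a :* x) := a :* (t :* x)) refl _ _ (lit 2) ⟩
    (1# - q) ^ k * (lit 2 * (1# + fromℕ k * q))  ≤⟨ *-monoˡ-≤-nonNeg _ (^-nonNeg k (x≤y⇒0≤y-x q≤1)) (2[1+kq]≤taylor₂ k q) ⟩
    (1# - q) ^ k * taylor₂ k q                   ≤⟨ [1-q]^k*taylor₂≤2 k 0≤q q≤1 ⟩
    lit 2                                        ≈⟨ *-identityʳ _ ⟨
    lit 2 * 1#                                   ∎)

  ⊓1-elim : ∀ {ℓ} {P : Carrier → Set ℓ} → (∀ {u v} → u ≈ v → P u → P v) →
            ∀ z → (z ≤ 1# → P z) → (1# ≤ z → P 1#) → P (z ⊓ 1#)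
  ⊓1-elim P-resp z z≤1⇒ 1≤z⇒ = [ (λ z≤1 → P-resp (sym (x≤y⇒x⊓y≈x z≤1)) (z≤1⇒ z≤1))
                               , (λ 1≤z → P-resp (sym (x≤y⇒y⊓x≈x 1≤z)) (1≤z⇒ 1≤z)) ]′ (total z 1#)

  ⊓1-nonNeg : ∀ {z} → 0# ≤ z → 0# ≤ z ⊓ 1#
  ⊓1-nonNeg 0≤z = ≤-respˡ-≈ (⊓-idem 0#) (⊓-mono-≤ 0≤z 0≤1)

  ⊓1≤2[1-γ] : ∀ {γ z} → 0# ≤ γ → 0# ≤ z → γ * (1# + z) ≤ 1# → z ⊓ 1# ≤ lit 2 * (1# - γ)
  ⊓1≤2[1-γ] {γ} {z} 0≤γ 0≤z γ[1+z]≤1 = ⊓1-elim (λ u≈v → ≤-respˡ-≈ u≈v) z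
    (λ z≤1 → [ (λ 2γ≤1 → ≤-trans z≤1 (≤-fromDifference
                 (solve 1 (λ γ → con (+ 2) :* (con (+ 1) :- γ) :- con (+ 1) := con (+ 1) :- con (+ 2) :* γ) refl γ)
                 (x≤y⇒0≤y-x 2γ≤1)))
             , (λ 1≤2γ → ≤-fromDifference
                 (solve 2 (λ γ z → con (+ 2) :* (con (+ 1) :- γ) :- z
                                   := con (+ 2) :* (con (+ 1) :- γ :* (con (+ 1) :+ z)) :+ z :* (con (+ 2) :* γ :- con (+ 1))) refl γ z)
                 (+-nonNeg (*-nonneg (lit-nonNeg 2) (x≤y⇒0≤y-x γ[1+z]≤1)) (*-nonneg 0≤z (x≤y⇒0≤y-x 1≤2γ))))
             ]′ (total (lit 2 * γ) 1#))
    (λ 1≤z → ≤-fromDifference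
      (solve 2 (λ γ z → con (+ 2) :* (con (+ 1) :- γ) :- con (+ 1)
                        := (con (+ 1) :- γ :* (con (+ 1) :+ z)) :+ γ :* (z :- con (+ 1))) refl γ z)
      (+-nonNeg (x≤y⇒0≤y-x γ[1+z]≤1) (*-nonneg 0≤γ (x≤y⇒0≤y-x 1≤z))))

  -- For a symbol of probability q, a q is its expected number of occurrences
  -- in a sample of size a, and b q ⊓ 1 bounds the probability that it occurs
  -- in a sample of size b.
  collisionWeight : ℕ → ℕ → Carrier → Carrier
  collisionWeight a b q = fromℕ a * q * (fromℕ b * q ⊓ 1#)

  collisionWeight-nonNeg : ∀ a b {q} → 0# ≤ q → 0# ≤ collisionWeight a b q
  collisionWeight-nonNeg a b 0≤q =
    *-nonneg (*-nonneg (fromℕ-nonNeg a) 0≤q) (⊓1-nonNeg (*-nonneg (fromℕ-nonNeg b) 0≤q))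

  module _ {a b : ℕ} (a≤b : a ℕ.≤ b) (200≤a : lit 200 ≤ fromℕ a) {q : Carrier} (0≤q : 0# ≤ q) (q≤1 : q ≤ 1#) where

    private
      x y α β w : Carrier
      x = fromℕ a * q
      y = fromℕ b * q
      α = (1# - q) ^ a
      β = (1# - q) ^ b
      w = collisionWeight a b q

      Q : Carrier → Carrier
      Q z = (lit 100 + lit 9 * z) * (lit 100 + lit 9 * z)

      0≤1-q : 0# ≤ 1# - q
      0≤1-q = x≤y⇒0≤y-x q≤1
      0≤x : 0# ≤ x
      0≤x = *-nonneg (fromℕ-nonNeg a) 0≤q
      0≤α : 0# ≤ α
      0≤α = ^-nonNeg a 0≤1-q
      0≤β : 0# ≤ β
      0≤β = ^-nonNeg b 0≤1-q
      0≤w : 0# ≤ w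
      0≤w = collisionWeight-nonNeg a b 0≤q

      -- For x ≤ 1, Bernoulli gives 1 - α ≥ x / 2 and 1 - β ≥ (y ⊓ 1) / 2,
      -- so 1 - mix α β = (1 - α) (1 - β) ≥ w / 4.
      x≤1⇒mix*Q≤10000 : x ≤ 1# → mix α β * Q w ≤ lit 10000
      x≤1⇒mix*Q≤10000 x≤1 = *-cancelˡ-≤-pos (lit 4) (lit-nonNeg 4) (lit-suc≉0 3) (begin
        lit 4 * (mix α β * Q w)
          ≈⟨ solve 3 (λ α β Q → con (+ 4) :* ((β :+ (con (+ 1) :- β) :* α) :* Q)
                               := (con (+ 4) :- con (+ 2) :* (con (+ 1) :- α) :* (con (+ 2) :* (con (+ 1) :- β))) :* Q) refl α β (Q w) ⟩
        (lit 4 - lit 2 * (1# - α) * (lit 2 * (1# - β))) * Q w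
          ≤⟨ *-monoʳ-≤-nonNeg (Q w) (square-nonNeg _) (+-monoʳ-≤ (lit 4) (neg-antimono-≤ w≤4[1-α][1-β])) ⟩
        (lit 4 - w) * Q w
          ≈⟨ solve 1 (λ w → (con (+ 4) :- w) :* ((con (+ 100) :+ con (+ 9) :* w) :* (con (+ 100) :+ con (+ 9) :* w))
                           := con (+ 40000) :- (con (+ 2800) :* w :+ con (+ 1476) :* (w :* w) :+ con (+ 81) :* (w :* (w :* w)))) refl w ⟩
        lit 40000 - (lit 2800 * w + lit 1476 * (w * w) + lit 81 * (w * (w * w)))
          ≤⟨ x-nonNeg≤x (+-nonNeg (+-nonNeg (*-nonneg (lit-nonNeg 2800) 0≤w)
                                            (*-nonneg (lit-nonNeg 1476) (*-nonneg 0≤w 0≤w)))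
                                  (*-nonneg (lit-nonNeg 81) (*-nonneg 0≤w (*-nonneg 0≤w 0≤w)))) ⟩
        lit 40000
          ≈⟨ solve 0 (con (+ 40000) := con (+ 4) :* con (+ 10000)) refl ⟩
        lit 4 * lit 10000
          ∎)
        where
        w≤4[1-α][1-β] : w ≤ lit 2 * (1# - α) * (lit 2 * (1# - β))
        w≤4[1-α][1-β] = *-mono-≤-nonNeg 0≤x
          (≤-trans (≤-reflexive (sym (x≤y⇒x⊓y≈x x≤1))) (⊓1≤2[1-γ] 0≤α 0≤x ([1-q]^k*[1+kq]≤1 a 0≤q q≤1)))
          (⊓1-nonNeg (*-nonneg (fromℕ-nonNeg b) 0≤q))
          (⊓1≤2[1-γ] 0≤β (*-nonneg (fromℕ-nonNeg b) 0≤q) ([1-q]^k*[1+kq]≤1 b 0≤q q≤1))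

      -- Since a ≥ 200, the term a (a - 1) q² of taylor₂ a q is at least (199/200) x².
      2Q≤5000taylor₂ : 1# ≤ x → lit 2 * Q x ≤ lit 5000 * taylor₂ a q
      2Q≤5000taylor₂ 1≤x = ≤-fromDifference
        (solve 2 (λ A q → con (+ 5000) :* (con (+ 2) :+ con (+ 2) :* (A :* q) :+ A :* (A :- con (+ 1)) :* (q :* q))
                          :- con (+ 2) :* ((con (+ 100) :+ con (+ 9) :* (A :* q)) :* (con (+ 100) :+ con (+ 9) :* (A :* q)))
                          := con (+ 25) :* (A :* q) :* ((A :- con (+ 200)) :* q)
                             :+ con (+ 4813) :* ((A :* q :- con (+ 1)) :* (A :* q :+ con (+ 1)))
                             :+ con (+ 6400) :* (A :* q :- con (+ 1)) :+ con (+ 1213)) refl (fromℕ a) q)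
        (+-nonNeg (+-nonNeg (+-nonNeg
          (*-nonneg (*-nonneg (lit-nonNeg 25) 0≤x) (*-nonneg (x≤y⇒0≤y-x 200≤a) 0≤q))
          (*-nonneg (lit-nonNeg 4813) (*-nonneg (x≤y⇒0≤y-x 1≤x) (+-nonNeg 0≤x 0≤1))))
          (*-nonneg (lit-nonNeg 6400) (x≤y⇒0≤y-x 1≤x)))
          (lit-nonNeg 1213))

      -- For x ≥ 1, mix α β ≤ 2 α and α ≤ 2 / taylor₂ a q, which is of order x⁻².
      1≤x⇒mix*Q≤10000 : 1# ≤ x → mix α β * Q w ≤ lit 10000
      1≤x⇒mix*Q≤10000 1≤x = begin
        mix α β * Q w                 ≤⟨ *-mono-≤-nonNeg (mix-nonNeg 0≤α 0≤β (^-≤1 b 0≤1-q (x-nonNeg≤x 0≤q))) mix≤2α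
                                                         (square-nonNeg _) (*-mono-≤-nonNeg 0≤lin lin-mono 0≤lin lin-mono) ⟩
        lit 2 * α * Q x               ≈⟨ solve 3 (λ α Q t → t :* α :* Q := α :* (t :* Q)) refl α (Q x) (lit 2) ⟩
        α * (lit 2 * Q x)             ≤⟨ *-monoˡ-≤-nonNeg α 0≤α (2Q≤5000taylor₂ 1≤x) ⟩
        α * (lit 5000 * taylor₂ a q)  ≈⟨ solve 3 (λ α D t → α :* (t :* D) := t :* (α :* D)) refl α (taylor₂ a q) (lit 5000) ⟩
        lit 5000 * (α * taylor₂ a q)  ≤⟨ *-monoˡ-≤-nonNeg (lit 5000) (lit-nonNeg 5000) ([1-q]^k*taylor₂≤2 a 0≤q q≤1) ⟩
        lit 5000 * lit 2              ≈⟨ solve 0 (con (+ 5000) :* con (+ 2) := con (+ 10000)) refl ⟩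
        lit 10000                     ∎
        where
        mix≤2α : mix α β ≤ lit 2 * α
        mix≤2α = ≤-fromDifference
          (solve 2 (λ α β → con (+ 2) :* α :- (β :+ (con (+ 1) :- β) :* α) := (α :- β) :+ β :* α) refl α β)
          (+-nonNeg (x≤y⇒0≤y-x (^-antitone a b 0≤1-q (x-nonNeg≤x 0≤q) a≤b)) (*-nonneg 0≤β 0≤α))
        0≤lin : 0# ≤ lit 100 + lit 9 * w
        0≤lin = +-nonNeg (lit-nonNeg 100) (*-nonneg (lit-nonNeg 9) 0≤w)
        lin-mono : lit 100 + lit 9 * w ≤ lit 100 + lit 9 * x
        lin-mono = +-monoʳ-≤ (lit 100) (*-monoˡ-≤-nonNeg (lit 9) (lit-nonNeg 9)
          (≤-respʳ-≈ (*-identityʳ x) (*-monoˡ-≤-nonNeg x 0≤x (x⊓y≤y y 1#))))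

    mix*[1+9hw]²≤1 : ∀ {h} → lit 100 * h ≈ 1# →
      mix ((1# - q) ^ a) ((1# - q) ^ b)
        * ((1# + lit 9 * h * collisionWeight a b q) * (1# + lit 9 * h * collisionWeight a b q)) ≤ 1#
    mix*[1+9hw]²≤1 {h} 100h≈1 = *-cancelˡ-≤-pos (lit 10000) (lit-nonNeg 10000) (lit-suc≉0 9999) (begin
      lit 10000 * (mix α β * ((1# + lit 9 * h * w) * (1# + lit 9 * h * w)))
        ≈⟨ solve 3 (λ f h w → con (+ 10000) :* (f :* ((con (+ 1) :+ con (+ 9) :* h :* w) :* (con (+ 1) :+ con (+ 9) :* h :* w)))
                             := f :* ((con (+ 100) :+ con (+ 9) :* w :* (con (+ 100) :* h)) :* (con (+ 100) :+ con (+ 9) :* w :* (con (+ 100) :* h))))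
                   refl (mix α β) h w ⟩
      mix α β * ((lit 100 + lit 9 * w * (lit 100 * h)) * (lit 100 + lit 9 * w * (lit 100 * h)))
        ≈⟨ *-congˡ (*-cong 100h-cancels 100h-cancels) ⟩
      mix α β * Q w
        ≤⟨ [ x≤1⇒mix*Q≤10000 , 1≤x⇒mix*Q≤10000 ]′ (total x 1#) ⟩
      lit 10000
        ≈⟨ *-identityʳ _ ⟨
      lit 10000 * 1#
        ∎)
      where
      100h-cancels : lit 100 + lit 9 * w * (lit 100 * h) ≈ lit 100 + lit 9 * w
      100h-cancels = +-congˡ (trans (*-congˡ 100h≈1) (*-identityʳ _))

  spread-term : ∀ {A B N ε q} → 0# ≤ A → 0# ≤ B → 0# ≤ N → 0# ≤ ε → 0# ≤ q → lit 2 * (B * ε) ≤ N →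
    A * B * (lit 2 * N * ε) * q - A * B * (ε * ε) ≤ N * (N * (A * q * (B * q ⊓ 1#)))
  spread-term {A} {B} {N} {ε} {q} 0≤A 0≤B 0≤N 0≤ε 0≤q 2Bε≤N =
    ⊓1-elim (λ u≈v → ≤-respʳ-≈ (*-congˡ (*-congˡ (*-congˡ u≈v)))) (B * q)
      (λ _ → ≤-fromDifference
        (solve 5 (λ A B N e q → N :* (N :* (A :* q :* (B :* q))) :- (A :* B :* (con (+ 2) :* N :* e) :* q :- A :* B :* (e :* e))
                                := A :* B :* ((N :* q :- e) :* (N :* q :- e))) refl A B N ε q)
        (*-nonneg (*-nonneg 0≤A 0≤B) (square-nonNeg _)))
      (λ _ → ≤-fromDifference
        (solve 5 (λ A B N e q → N :* (N :* (A :* q :* con (+ 1))) :- (A :* B :* (con (+ 2) :* N :* e) :* q :- A :* B :* (e :* e))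
                                := A :* q :* N :* (N :- con (+ 2) :* (B :* e)) :+ A :* B :* (e :* e)) refl A B N ε q)
        (+-nonNeg (*-nonneg (*-nonneg (*-nonneg 0≤A 0≤q) 0≤N) (x≤y⇒0≤y-x 2Bε≤N))
                  (*-nonneg (*-nonneg 0≤A 0≤B) (*-nonneg 0≤ε 0≤ε))))

  concentrated-term : ∀ {A B q} → 0# ≤ A → lit 4 * A * B * q - A ≤ lit 4 * (B * (A * q * (B * q ⊓ 1#)))
  concentrated-term {A} {B} {q} 0≤A =
    ⊓1-elim (λ u≈v → ≤-respʳ-≈ (*-congˡ (*-congˡ (*-congˡ u≈v)))) (B * q)
      (λ _ → ≤-fromDifference
        (solve 3 (λ A B q → con (+ 4) :* (B :* (A :* q :* (B :* q))) :- (con (+ 4) :* A :* B :* q :- A)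
                            := A :* ((con (+ 2) :* B :* q :- con (+ 1)) :* (con (+ 2) :* B :* q :- con (+ 1)))) refl A B q)
        (*-nonneg 0≤A (square-nonNeg _)))
      (λ _ → ≤-fromDifference
        (solve 3 (λ A B q → con (+ 4) :* (B :* (A :* q :* con (+ 1))) :- (con (+ 4) :* A :* B :* q :- A) := A) refl A B q)
        0≤A)

  -- If 2 b ε ≤ n, summing spread-term (a Cauchy–Schwarz estimate) gives n² W ≥ n a b ε²;
  -- otherwise summing concentrated-term gives 4 b W ≥ 4 a b ε - n a ≥ 2 b · a ε.
  100≤sumFin-collisionWeight : ∀ n → ¬ (fromℕ n ≈ 0#) → (q : Fin n → Carrier) → (∀ j → 0# ≤ q j) →
    ∀ a b → ¬ (fromℕ b ≈ 0#) →
    lit 200 ≤ fromℕ a * sumFin n q →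
    lit 100 * fromℕ n ≤ fromℕ a * fromℕ b * (sumFin n q * sumFin n q) →
    lit 100 ≤ sumFin n (λ j → collisionWeight a b (q j))
  100≤sumFin-collisionWeight n N≉0 q 0≤q a b B≉0 200≤Aε 100N≤ABε² =
    [ spread , concentrated ]′ (total (lit 2 * (B * ε)) N)
    where
    A B N ε W : Carrier
    A = fromℕ a
    B = fromℕ b
    N = fromℕ n
    ε = sumFin n q
    W = sumFin n (λ j → collisionWeight a b (q j))
    0≤A = fromℕ-nonNeg a
    0≤B = fromℕ-nonNeg b
    0≤N = fromℕ-nonNeg n

    spread : lit 2 * (B * ε) ≤ N → lit 100 ≤ W
    spread 2Bε≤N = *-cancelˡ-≤-pos N 0≤N N≉0 (*-cancelˡ-≤-pos N 0≤N N≉0 (begin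
      N * (N * lit 100)      ≈⟨ *-congˡ (*-comm N (lit 100)) ⟩
      N * (lit 100 * N)      ≤⟨ *-monoˡ-≤-nonNeg N 0≤N 100N≤ABε² ⟩
      N * (A * B * (ε * ε))  ≈⟨ solve 4 (λ A B N e → N :* (A :* B :* (e :* e))
                                                      := A :* B :* (con (+ 2) :* N :* e) :* e :- N :* (A :* B :* (e :* e)))
                                         refl A B N ε ⟩
      A * B * (lit 2 * N * ε) * ε - N * (A * B * (ε * ε))
                             ≈⟨ sumFin-affine n _ _ q ⟨
      sumFin n (λ j → A * B * (lit 2 * N * ε) * q j - A * B * (ε * ε))
                             ≤⟨ sumFin-mono-≤ n (λ j → spread-term 0≤A 0≤B 0≤N (sumFin-nonNeg n 0≤q) (0≤q j) 2Bε≤N) ⟩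
      sumFin n (λ j → N * (N * collisionWeight a b (q j)))
                             ≈⟨ trans (sumFin-*ˡ n N _) (*-congˡ (sumFin-*ˡ n N _)) ⟩
      N * (N * W)            ∎))

    concentrated : N ≤ lit 2 * (B * ε) → lit 100 ≤ W
    concentrated N≤2Bε = *-cancelˡ-≤-pos B 0≤B B≉0 (*-cancelˡ-≤-pos (lit 4) (lit-nonNeg 4) (lit-suc≉0 3) (begin
      lit 4 * (B * lit 100)        ≈⟨ solve 1 (λ B → con (+ 4) :* (B :* con (+ 100)) := con (+ 2) :* B :* con (+ 200)) refl B ⟩
      lit 2 * B * lit 200          ≤⟨ *-monoˡ-≤-nonNeg _ (*-nonneg (lit-nonNeg 2) 0≤B) 200≤Aε ⟩
      lit 2 * B * (A * ε)          ≈⟨ solve 3 (λ A B e → con (+ 2) :* B :* (A :* e)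
                                                        := con (+ 4) :* A :* B :* e :- A :* (con (+ 2) :* (B :* e))) refl A B ε ⟩
      lit 4 * A * B * ε - A * (lit 2 * (B * ε))
                                   ≤⟨ +-monoʳ-≤ _ (neg-antimono-≤ (≤-respˡ-≈ (*-comm A N) (*-monoˡ-≤-nonNeg A 0≤A N≤2Bε))) ⟩
      lit 4 * A * B * ε - N * A    ≈⟨ sumFin-affine n _ _ q ⟨
      sumFin n (λ j → lit 4 * A * B * q j - A)
                                   ≤⟨ sumFin-mono-≤ n (λ j → concentrated-term 0≤A) ⟩
      sumFin n (λ j → lit 4 * (B * collisionWeight a b (q j)))
                                   ≈⟨ trans (sumFin-*ˡ n _ _) (*-congˡ (sumFin-*ˡ n B _)) ⟩
      lit 4 * (B * W)              ∎))

  prodFin-*-square-≤1 : ∀ k (f t : Fin k → Carrier) → (∀ j → 0# ≤ f j) → (∀ j → 0# ≤ t j) →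
    (∀ j → f j * ((1# + t j) * (1# + t j)) ≤ 1#) →
    prodFin k f * ((1# + sumFin k t) * (1# + sumFin k t)) ≤ 1#
  prodFin-*-square-≤1 k f t 0≤f 0≤t f[1+t]²≤1 = begin
    prodFin k f * ((1# + sumFin k t) * (1# + sumFin k t))
      ≤⟨ *-monoˡ-≤-nonNeg _ (prodFin-nonNeg k 0≤f) (*-mono-≤-nonNeg 0≤1+Σt 1+Σt≤Π 0≤1+Σt 1+Σt≤Π) ⟩
    prodFin k f * (prodFin k (λ j → 1# + t j) * prodFin k (λ j → 1# + t j))
      ≈⟨ trans (prodFin-* k f _) (*-congˡ (prodFin-* k _ _)) ⟨
    prodFin k (λ j → f j * ((1# + t j) * (1# + t j)))
      ≤⟨ prodFin-≤1 k (λ j → *-nonneg (0≤f j) (square-nonNeg _)) f[1+t]²≤1 ⟩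
    1# ∎
    where
    0≤1+Σt : 0# ≤ 1# + sumFin k t
    0≤1+Σt = +-nonNeg 0≤1 (sumFin-nonNeg k 0≤t)
    1+Σt≤Π : 1# + sumFin k t ≤ prodFin k (λ j → 1# + t j)
    1+Σt≤Π = 1+sumFin≤prodFin-1+ k t 0≤t

  200≤k*x⇒fromℕ-k≉0 : ∀ {k x} → lit 200 ≤ fromℕ k * x → ¬ (fromℕ k ≈ 0#)
  200≤k*x⇒fromℕ-k≉0 {k} {x} 200≤kx k≈0 = lit-suc≉0 199
    (antisym (≤-respʳ-≈ (trans (*-congʳ k≈0) (zeroˡ x)) 200≤kx) (lit-nonNeg 200))

  100*prodFin-mix≤1-ordered : ∀ n → ¬ (fromℕ n ≈ 0#) → (q : Fin n → Carrier) → (∀ j → 0# ≤ q j) →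
    sumFin n q ≤ 1# → ∀ a b → a ℕ.≤ b →
    lit 200 ≤ fromℕ a * sumFin n q → lit 200 ≤ fromℕ b * sumFin n q →
    lit 100 * fromℕ n ≤ fromℕ a * fromℕ b * (sumFin n q * sumFin n q) →
    lit 100 * prodFin n (λ j → mix ((1# - q j) ^ a) ((1# - q j) ^ b)) ≤ 1#
  100*prodFin-mix≤1-ordered n N≉0 q 0≤q ε≤1 a b a≤b 200≤Aε 200≤Bε 100N≤ABε² = begin
    lit 100 * prodFin n f            ≈⟨ solve 1 (λ P → con (+ 100) :* P := P :* (con (+ 10) :* con (+ 10))) refl (prodFin n f) ⟩
    prodFin n f * (lit 10 * lit 10)  ≤⟨ *-monoˡ-≤-nonNeg _ (prodFin-nonNeg n 0≤f)
                                          (*-mono-≤-nonNeg (lit-nonNeg 10) 10≤1+Σt (lit-nonNeg 10) 10≤1+Σt) ⟩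
    prodFin n f * ((1# + sumFin n t) * (1# + sumFin n t))
                                     ≤⟨ prodFin-*-square-≤1 n f t 0≤f 0≤t
                                          (λ j → mix*[1+9hw]²≤1 a≤b 200≤A (0≤q j) (q≤1 j) 100h≈1) ⟩
    1#                               ∎
    where
    f : Fin n → Carrier
    f j = mix ((1# - q j) ^ a) ((1# - q j) ^ b)
    q≤1 : ∀ j → q j ≤ 1#
    q≤1 j = ≤-trans (term≤sumFin n 0≤q j) ε≤1
    0≤f : ∀ j → 0# ≤ f j
    0≤f j = mix-nonNeg (^-nonNeg a (x≤y⇒0≤y-x (q≤1 j))) (^-nonNeg b (x≤y⇒0≤y-x (q≤1 j)))
                       (^-≤1 b (x≤y⇒0≤y-x (q≤1 j)) (x-nonNeg≤x (0≤q j)))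
    200≤A : lit 200 ≤ fromℕ a
    200≤A = ≤-trans 200≤Aε (≤-respʳ-≈ (*-identityʳ _) (*-monoˡ-≤-nonNeg _ (fromℕ-nonNeg a) ε≤1))
    h : Carrier
    h = proj₁ (inverse (lit 100) (lit-suc≉0 99))
    100h≈1 : lit 100 * h ≈ 1#
    100h≈1 = proj₂ (inverse (lit 100) (lit-suc≉0 99))
    0≤9h : 0# ≤ lit 9 * h
    0≤9h = *-nonneg (lit-nonNeg 9) (inverse-nonNeg (lit-nonNeg 100) 100h≈1)
    t : Fin n → Carrier
    t j = lit 9 * h * collisionWeight a b (q j)
    0≤t : ∀ j → 0# ≤ t j
    0≤t j = *-nonneg 0≤9h (collisionWeight-nonNeg a b (0≤q j))
    10≤1+Σt : lit 10 ≤ 1# + sumFin n t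
    10≤1+Σt = begin
      lit 10                      ≈⟨ solve 0 (con (+ 10) := con (+ 1) :+ con (+ 9)) refl ⟩
      1# + lit 9                  ≈⟨ +-congˡ (*-identityʳ _) ⟨
      1# + lit 9 * 1#             ≈⟨ +-congˡ (trans (*-congˡ (sym 100h≈1))
                                       (solve 2 (λ h t → t :* (con (+ 100) :* h) := t :* h :* con (+ 100)) refl h (lit 9))) ⟩
      1# + lit 9 * h * lit 100    ≤⟨ +-monoʳ-≤ 1# (*-monoˡ-≤-nonNeg _ 0≤9h
                                       (100≤sumFin-collisionWeight n N≉0 q 0≤q a b (200≤k*x⇒fromℕ-k≉0 {b} 200≤Bε)
                                                                   200≤Aε 100N≤ABε²)) ⟩
      1# + lit 9 * h * sumFin n (λ j → collisionWeight a b (q j))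
                                  ≈⟨ +-congˡ (sumFin-*ˡ n _ _) ⟨
      1# + sumFin n t             ∎

  100*prodFin-mix≤1 : ∀ n → ¬ (fromℕ n ≈ 0#) → (q : Fin n → Carrier) → (∀ j → 0# ≤ q j) →
    sumFin n q ≤ 1# → ∀ a b →
    fromℕ (100 ℕ.* n) ≤ fromℕ (a ℕ.* b) * (sumFin n q * sumFin n q) →
    fromℕ 200 ≤ fromℕ a * sumFin n q → fromℕ 200 ≤ fromℕ b * sumFin n q →
    lit 100 * prodFin n (λ j → mix ((1# - q j) ^ a) ((1# - q j) ^ b)) ≤ 1#
  100*prodFin-mix≤1 n N≉0 q 0≤q ε≤1 a b 100n≤abε² 200≤aε 200≤bε = [ a≤b⇒ , b≤a⇒ ]′ (ℕₚ.≤-total a b)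
    where
    lit200≤ : ∀ {x} → fromℕ 200 ≤ x → lit 200 ≤ x
    lit200≤ = ≤-respˡ-≈ (sym (lit≈fromℕ 200))
    100N≤ : ∀ a b → fromℕ (100 ℕ.* n) ≤ fromℕ (a ℕ.* b) * (sumFin n q * sumFin n q) →
            lit 100 * fromℕ n ≤ fromℕ a * fromℕ b * (sumFin n q * sumFin n q)
    100N≤ a b = ≤-respˡ-≈ (trans (fromℕ-* 100 n) (*-congʳ (sym (lit≈fromℕ 100))))
              ∘ ≤-respʳ-≈ (*-congʳ (fromℕ-* a b))
    a≤b⇒ : a ℕ.≤ b → lit 100 * prodFin n (λ j → mix ((1# - q j) ^ a) ((1# - q j) ^ b)) ≤ 1#
    a≤b⇒ a≤b = 100*prodFin-mix≤1-ordered n N≉0 q 0≤q ε≤1 a b a≤b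
                 (lit200≤ 200≤aε) (lit200≤ 200≤bε) (100N≤ a b 100n≤abε²)
    b≤a⇒ : b ℕ.≤ a → lit 100 * prodFin n (λ j → mix ((1# - q j) ^ a) ((1# - q j) ^ b)) ≤ 1#
    b≤a⇒ b≤a = ≤-respˡ-≈ (*-congˡ (prodFin-cong n (λ j → mix-comm _ _)))
                 (100*prodFin-mix≤1-ordered n N≉0 q 0≤q ε≤1 b a b≤a (lit200≤ 200≤bε) (lit200≤ 200≤aε)
                   (100N≤ b a (≤-respʳ-≈ (*-congʳ (reflexive (≡.cong fromℕ (ℕₚ.*-comm a b)))) 100n≤abε²)))

lemma6p2 : ∀ {c ℓ₁ ℓ₂ : Level} (F : OrderedField c ℓ₁ ℓ₂) →
    let open OrderedField F in
    (n : ℕ) → .{{_ : NonZero n}} →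
    (p : Fin (suc n) → Carrier) → IsDistribution p →
    (m m' : ℕ) →
    let ε = sumFin n (λ i → p (inject₁ i)) in
    0# < ε →
    fromℕ (100 *ℕ n) ≤ (fromℕ (m *ℕ m') * (ε * ε)) →
    fromℕ 200 ≤ (fromℕ m * ε) →
    fromℕ 200 ≤ (fromℕ m' * ε) →
    fromℕ 99 ≤ (fromℕ 100 * Prob2 m m' p CommonElement commonElement?)
lemma6p2 F n p p-dist m m' _ 100n≤mm'ε² 200≤mε 200≤m'ε = begin
  fromℕ 99                                       ≈⟨ trans (sym (lit≈fromℕ 99)) (solve 0 (con (+ 99) := con (+ 100) :- con (+ 1)) refl) ⟩
  lit 100 - 1#                                   ≤⟨ +-monoʳ-≤ (lit 100) (neg-antimono-≤ 100Π≤1) ⟩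
  lit 100 - lit 100 * Π                          ≈⟨ solve 1 (λ x → con (+ 100) :- con (+ 100) :* x
                                                                   := con (+ 100) :* (con (+ 1) :- x)) refl Π ⟩
  lit 100 * (1# - Π)                             ≤⟨ *-monoˡ-≤-nonNeg (lit 100) (lit-nonNeg 100) (Prob2-common-≥ p-dist m m') ⟩
  lit 100 * Prob2 m m' p CommonElement commonElement?
                                                 ≈⟨ *-congʳ (lit≈fromℕ 100) ⟩
  fromℕ 100 * Prob2 m m' p CommonElement commonElement? ∎
  where
  open OrderedFieldProperties F
  open BigOperators F
  open Sampling F
  open CommonElements F
  open Estimates F
  open ≤-Reasoning
  q : Fin n → Carrier
  q i = p (inject₁ i)
  Π : Carrier
  Π = prodFin n (λ j → mix ((1# - q j) ^ m) ((1# - q j) ^ m'))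
  100Π≤1 : lit 100 * Π ≤ 1#
  100Π≤1 = 100*prodFin-mix≤1 n (fromℕ-nonZero≉0 n) q (λ j → proj₁ p-dist (inject₁ j)) (sumFin-inject₁≤1 p-dist)
             m m' 100n≤mm'ε² 200≤mε 200≤m'ε
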